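{- Let $m$ be a divisor of $n$, let $\xi$ be a primitive element of $\mathbb{F}_{2^n}$, and let $g=(2^n-1)/(2^m-1)$. The following are equivalent: (i) there exists a group divisible triangle design $(V,\mathcal{G},\mathcal{B})$ of order $n$ with groups of dimension $m$ over $\mathbb{F}_2$, where $V=\mathbb{F}_{2^n}$, $\mathcal{G}$ is the Desarguesian spread $\{a\mathbb{F}_{2^m}: a\in\mathbb{F}_{2^n}^*\}$ (the multiplicative cosets of the subfield $\mathbb{F}_{2^m}$), and $\mathcal{B}$ is invariant under the action of the multiplicative group $\mathbb{F}_{2^n}^*$ (any such design being balanced); (ii) there exists a partition of $\mathbb{Z}_{2^n-1}\setminus g\mathbb{Z}_{2^n-1}$ into $18$-element subsets of the form $\Gamma(k_1)\,\dot\cup\,\Gamma(k_2)\,\dot\cup\,\Gamma(k_3)$ (disjoint union) with $k_1+k_2+k_3=0$; equivalently, a partition of $\{\Gamma(k): k\in\mathbb{Z}_{2^n-1}\setminus g\mathbb{Z}_{2^n-1}\}$ into $3$-element subsets $\{\Gamma(k_1),\Gamma(k_2),\Gamma(k_3)\}$ with $k_1+k_2+k_3=0$.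
   Context: For a vector space $V$ over $\mathbb{F}_q$, a triangle is a set $\{\langle a,b\rangle,\langle b,c\rangle,\langle c,a\rangle\}$ of three $2$-dimensional subspaces with $a,b,c$ linearly independent. For $m\mid n$, a group divisible triangle design of order $n$ with groups of dimension $m$ over $\mathbb{F}_q$ is a triple $(V,\mathcal{G},\mathcal{B})$: $V$ an $n$-dimensional $\mathbb{F}_q$-space, $\mathcal{G}$ a set of $m$-dimensional subspaces such that every nonzero vector lies in exactly one, and $\mathcal{B}$ a set of triangles such that every $2$-dimensional subspace either belongs to exactly one triangle of $\mathcal{B}$ and to no group, or to no triangle and to one group. A triangle covers a nonzero vector $x$ if $x$ lies in one of its three subspaces; the design is balanced if all nonzero vectors are covered by the same number of triangles of $\mathcal{B}$. Invariance under $\mathbb{F}_{2^n}^*$ means that for each $\gamma\in\mathbb{F}_{2^n}^*$ the map $y\mapsto\gamma y$ maps $\mathcal{B}$ onto itself. Elements of $\mathbb{Z}_{2^n-1}$ are exponents of $\xi$ (arithmetic mod $2^n-1$). For nonzero $k\in\mathbb{Z}_{2^n-1}$, the Zech logarithm $\mathrm{Z}(k)$ is defined by $1+\xi^k=\xi^{\mathrm{Z}(k)}$, and $\Gamma(k)=\{k,\mathrm{Z}(k),\mathrm{Z}(-k),-\mathrm{Z}(-k),-\mathrm{Z}(k),-k\}$. -}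

module Defs where

open import Level using (0ℓ)
open import Function using (id)
open import Data.Nat as ℕ using (ℕ; zero; suc; _∸_; _^_)
open import Data.Nat.DivMod using (_mod_; _/_)
open import Data.Fin using (Fin; toℕ)
open import Data.Product using (Σ; ∃; _×_; _,_)
open import Data.Sum using (_⊎_)
open import Data.List using (List; []; _∷_; _++_)
open import Data.List.Relation.Unary.All using (All)
open import Data.List.Relation.Unary.Unique.Propositional using (Unique)
open import Data.List.Membership.Propositional using (_∈_)
open import Relation.Nullary using (¬_)
open import Relation.Binary.PropositionalEquality using (_≡_; _≢_)
open import Algebra.Structures using (IsCommutativeRing)

pow : {A : Set} → (A → A → A) → A → A → ℕ → A
pow _*_ one x zero    = one
pow _*_ one x (suc k) = x * pow _*_ one x k

addZ : ∀ {N} → Fin N → Fin N → Fin N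
addZ {zero}  ()
addZ {suc N} i j = (toℕ i ℕ.+ toℕ j) mod (suc N)

negZ : ∀ {N} → Fin N → Fin N
negZ {zero}  ()
negZ {suc N} i = (suc N ∸ toℕ i) mod (suc N)

scaleZ : ∀ {N} → ℕ → Fin N → Fin N
scaleZ {zero}  g ()
scaleZ {suc N} g i = (g ℕ.* toℕ i) mod (suc N)

-- natural-number division returning 0 for divisor 0 (never used in that case)
div' : ℕ → ℕ → ℕ
div' a zero    = 0
div' a (suc d) = a / suc d

-- A commutative ring of characteristic 2 (negation is the identity),
-- with 1 ≠ 0, and an element ξ of multiplicative order exactly 2^n - 1
-- (ξ^(2^n-1) = 1 and ξ^0,…,ξ^(2^n-2) pairwise distinct) whose powers
-- exhaust the nonzero elements.  Such a structure is exactly (up to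
-- isomorphism) F_{2^n} with a chosen primitive element.  `log` is the
-- discrete logarithm (its value at 0 is irrelevant).

record GF2 (n : ℕ) : Set₁ where
  field
    Carrier : Set
    _+_ _*_ : Carrier → Carrier → Carrier
    0# 1#   : Carrier
    isCommutativeRing : IsCommutativeRing _≡_ _+_ _*_ id 0# 1#
    1≢0     : 1# ≢ 0#
    ξ       : Carrier
    ξ^N≡1   : pow _*_ 1# ξ (2 ^ n ∸ 1) ≡ 1#
    ξ-inj   : (i j : Fin (2 ^ n ∸ 1)) →
              pow _*_ 1# ξ (toℕ i) ≡ pow _*_ 1# ξ (toℕ j) → i ≡ j
    log     : Carrier → Fin (2 ^ n ∸ 1)
    ξ^log   : ∀ x → x ≢ 0# → pow _*_ 1# ξ (toℕ (log x)) ≡ x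

module Design {n : ℕ} (K : GF2 n) (m : ℕ) where
  open GF2 K public

  F : Set
  F = Carrier

  _^F_ : F → ℕ → F
  x ^F k = pow _*_ 1# x k

  N : ℕ
  N = 2 ^ n ∸ 1

  g : ℕ
  g = div' N (2 ^ m ∸ 1)

  Indep2 : F → F → Set
  Indep2 a b = a ≢ 0# × b ≢ 0# × a ≢ b

  Indep3 : F → F → F → Set
  Indep3 a b c = Indep2 a b × c ≢ 0# × c ≢ a × c ≢ b × c ≢ a + b

  Span : F → F → F → Set
  Span a b x = x ≡ 0# ⊎ x ≡ a ⊎ x ≡ b ⊎ x ≡ a + b

  SameSet : (F → Set) → (F → Set) → Set
  SameSet S T = ∀ x → (S x → T x) × (T x → S x)

  Triple : Set
  Triple = F × F × F

  InTri : (F → Set) → Triple → Set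
  InTri S (a , b , c) =
    SameSet S (Span a b) ⊎ SameSet S (Span b c) ⊎ SameSet S (Span c a)

  SameTri : Triple → Triple → Set
  SameTri (a , b , c) (a' , b' , c') =
    (InTri (Span a b) (a' , b' , c') × InTri (Span b c) (a' , b' , c')
                                     × InTri (Span c a) (a' , b' , c'))
    × (InTri (Span a' b') (a , b , c) × InTri (Span b' c') (a , b , c)
                                      × InTri (Span c' a') (a , b , c))

  scaleT : F → Triple → Triple
  scaleT γ (a , b , c) = (γ * a , γ * b , γ * c)

  Covers : Triple → F → Set
  Covers (a , b , c) x = Span a b x ⊎ Span b c x ⊎ Span c a x

  Subfield : F → Set
  Subfield x = x ^F (2 ^ m) ≡ x

  Group : F → F → Set
  Group c x = ∃ λ s → Subfield s × x ≡ c * s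

  InGroup : (F → Set) → F → Set
  InGroup S c = ∀ x → S x → Group c x

  InSomeGroup : (F → Set) → Set
  InSomeGroup S = ∃ λ c → c ≢ 0# × InGroup S c

  InExactlyOneGroup : (F → Set) → Set
  InExactlyOneGroup S =
    InSomeGroup S ×
    (∀ c c' → c ≢ 0# → c' ≢ 0# → InGroup S c → InGroup S c' →
       SameSet (Group c) (Group c'))

  ---------------- designs ----------------
  -- A set of triangles is given by a predicate B on triples; the triangle
  -- set is { triangle(t) : B t }.

  CoveredByB : (Triple → Set) → (F → Set) → Set
  CoveredByB B S = ∃ λ t → B t × InTri S t

  UniqueTriInB : (Triple → Set) → (F → Set) → Set
  UniqueTriInB B S = ∀ t t' → B t → InTri S t → B t' → InTri S t' → SameTri t t'

  IsGDTD : (Triple → Set) → Set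
  IsGDTD B =
    (∀ a b c → B (a , b , c) → Indep3 a b c) ×
    (∀ a b → Indep2 a b →
       (CoveredByB B (Span a b) × UniqueTriInB B (Span a b)
          × ¬ InSomeGroup (Span a b))
       ⊎ (¬ CoveredByB B (Span a b) × InExactlyOneGroup (Span a b)))

  Invariant : (Triple → Set) → Set
  Invariant B = ∀ γ → γ ≢ 0# →
    (∀ t → B t → ∃ λ t' → B t' × SameTri (scaleT γ t) t') ×
    (∀ t → B t → ∃ λ t' → B t' × SameTri (scaleT γ t') t)

  -- balanced: for nonzero x, y the sets of triangles of B covering x and
  -- covering y have the same cardinality, i.e. there is a map between the
  -- representing triples inducing a bijection on triangles.
  CovSet : (Triple → Set) → F → Set
  CovSet B x = Σ Triple λ t → B t × Covers t x

  Balanced : (Triple → Set) → Set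
  Balanced B = ∀ x y → x ≢ 0# → y ≢ 0# →
    Σ (CovSet B x → CovSet B y) λ φ →
      (∀ (u v : CovSet B x) → SameTri (Data.Product.proj₁ u) (Data.Product.proj₁ v) →
               SameTri (Data.Product.proj₁ (φ u)) (Data.Product.proj₁ (φ v))) ×
      (∀ (u v : CovSet B x) → SameTri (Data.Product.proj₁ (φ u)) (Data.Product.proj₁ (φ v)) →
               SameTri (Data.Product.proj₁ u) (Data.Product.proj₁ v)) ×
      (∀ (w : CovSet B y) → ∃ λ (u : CovSet B x) → SameTri (Data.Product.proj₁ (φ u)) (Data.Product.proj₁ w))

  DesignExists : Set₁
  DesignExists = Σ (Triple → Set) λ B → IsGDTD B × Invariant B

  -- Zech logarithm: 1 + ξ^k = ξ^Z(k)  (meaningful for k ≠ 0)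
  Zech : Fin N → Fin N
  Zech k = log (1# + (ξ ^F toℕ k))

  Γ : Fin N → List (Fin N)
  Γ k = k ∷ Zech k ∷ Zech (negZ k) ∷ negZ (Zech (negZ k))
          ∷ negZ (Zech k) ∷ negZ k ∷ []

  InGZ : Fin N → Set
  InGZ i = ∃ λ (j : Fin N) → i ≡ scaleZ g j

  Block : Fin N × Fin N × Fin N → List (Fin N)
  Block (k₁ , k₂ , k₃) = Γ k₁ ++ Γ k₂ ++ Γ k₃

  SameList : List (Fin N) → List (Fin N) → Set
  SameList xs ys = ∀ j → (j ∈ xs → j ∈ ys) × (j ∈ ys → j ∈ xs)

  IsPartition : (Fin N × Fin N × Fin N → Set) → Set
  IsPartition P =
    (∀ k₁ k₂ k₃ → P (k₁ , k₂ , k₃) → toℕ (addZ (addZ k₁ k₂) k₃) ≡ 0) ×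
    (∀ t → P t → Unique (Block t)) ×
    (∀ t → P t → All (λ i → ¬ InGZ i) (Block t)) ×
    (∀ i → ¬ InGZ i → ∃ λ (t : Fin N × Fin N × Fin N) → P t × i ∈ Block t) ×
    (∀ i t t' → P t → P t' → i ∈ Block t → i ∈ Block t' →
       SameList (Block t) (Block t'))

  PartitionExists : Set₁
  PartitionExists = Σ (Fin N × Fin N × Fin N → Set) IsPartition

{-# OPTIONS --safe #-}
module Submission where

-- Write F* = {ξ^k}. The six ordered pairs (x, y) of distinct nonzero vectors of a line
-- ⟨c, ξ^k c⟩ have ratios y/x = ξ^j for j ∈ Γ(k) (Γ-ratio), and the line lies in a group
-- c·F_{2^m} iff ξ^k ∈ F_{2^m}, i.e. iff k ∈ gℤ_N. Every triangle is a scalar multiple of a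
-- normalised one (1, ξ^k₁, ξ^(k₁+k₂)) with k₁ + k₂ + k₃ = 0, whose sides have ratios ξ^k₁,
-- ξ^k₂, ξ^k₃; so the lines covered by its F*-orbit are those whose ratio exponent lies in the
-- block Γ(k₁) ∪ Γ(k₂) ∪ Γ(k₃). For an invariant design these blocks partition ℤ_N ∖ gℤ_N, and
-- their 18 entries are distinct because no scalar δ ≠ 1 fixes a triangle (δ would permute the
-- corners and fix their nonzero sum). Conversely, one normalised triangle per block together
-- with its scalar multiples is an invariant design. Balance needs invariance alone: y/x maps
-- the triangles covering x onto those covering y.

open import Defs
open import Data.Nat using (ℕ)
open import Data.Nat.Divisibility using (_∣_)
open import Data.Product using (_×_)
open import Function.Bundles using (_⇔_; mk⇔)

open import Data.Nat as ℕ using (zero; suc; _∸_; _^_; _<_)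
import Data.Nat.Properties as ℕ
open import Data.Nat.Divisibility using (divides; ∣m∣n⇒∣m+n; n∣m*n; m%n≡0⇒n∣m; 0∣⇒≡0; *-cancelʳ-∣)
open import Data.Nat.DivMod using (_/_; _%_; _mod_; m≡m%n+[m/n]*n; m%n<n; m<n⇒m%n≡m; m/n*n≡m)
open import Data.Fin as Fin using (Fin; toℕ; fromℕ<; remQuot; combine)
open import Data.Fin.Properties using (toℕ-fromℕ<; toℕ<n; toℕ-injective; remQuot-combine; combine-remQuot; any?; ≤-totalOrder; ≤-antisym)
import Data.List.Extrema as Extrema
open import Data.Fin.Patterns using (0F; 1F; 2F; 3F; 4F; 5F)
open import Data.Product using (∃; _,_; proj₁; proj₂; uncurry)
open import Data.Sum using (inj₁; inj₂; [_,_]′)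
open import Data.Empty using (⊥-elim)
open import Function using (id; _∘_; _∋_; case_of_)
open import Data.List using (tabulate)
open import Data.List.Relation.Unary.All as All using (All)
open import Data.List.Relation.Unary.AllPairs using (_∷_)
open import Data.List.Relation.Unary.Unique.Propositional using (Unique)
open import Data.List.Relation.Unary.Unique.Propositional.Properties using (tabulate⁺)
open import Data.List.Membership.Propositional using (_∈_)
open import Data.List.Membership.Propositional.Properties using (∈-tabulate⁺; ∈-tabulate⁻)
open import Relation.Nullary using (¬_; yes; no; Dec)
open import Relation.Binary.PropositionalEquality
open import Algebra.Bundles using (CommutativeRing)
open import Data.Nat.Solver using (module +-*-Solver)
open import Algebra.Structures using (IsCommutativeRing)
open import Tactic.RingSolver.Core.AlmostCommutativeRing using (fromCommutativeRing)
open import Data.Maybe using (nothing)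
import Algebra.Properties.CommutativeSemiring.Exp as Exp
import Algebra.Properties.CommutativeSemigroup as CommutativeSemigroupProperties
import Tactic.RingSolver.NonReflective as RingSolver

Residue : ∀ {N} → Fin N → ℕ → Set
Residue {N} i x = ∃ λ q → toℕ i ℕ.+ q ℕ.* N ≡ x

mod-residue : ∀ N x → Residue (x mod suc N) x
mod-residue N x = x / suc N , trans (cong (ℕ._+ x / suc N ℕ.* suc N) (toℕ-fromℕ< (m%n<n x (suc N))))
                                    (sym (m≡m%n+[m/n]*n x (suc N)))

addZ-residue : ∀ {N} (i j : Fin N) → Residue (addZ i j) (toℕ i ℕ.+ toℕ j)
addZ-residue {suc N} i j = mod-residue N (toℕ i ℕ.+ toℕ j)

negZ-residue : ∀ {N} (i : Fin N) → Residue (negZ i) (N ∸ toℕ i)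
negZ-residue {suc N} i = mod-residue N (suc N ∸ toℕ i)

scaleZ-residue : ∀ {N} g (j : Fin N) → Residue (scaleZ g j) (g ℕ.* toℕ j)
scaleZ-residue {suc N} g j = mod-residue N (g ℕ.* toℕ j)

toℕ-scaleZ : ∀ {N} g (j : Fin N) → g ℕ.* toℕ j < N → toℕ (scaleZ g j) ≡ g ℕ.* toℕ j
toℕ-scaleZ {suc N} g j lt = trans (toℕ-fromℕ< _) (m<n⇒m%n≡m lt)

m∣[1+m]^k∸1 : ∀ m k → m ∣ suc m ^ k ∸ 1
m∣[1+m]^k∸1 m zero = divides 0 refl
m∣[1+m]^k∸1 m (suc k) with suc m ^ k | m∣[1+m]^k∸1 m k | ℕ.m^n>0 (suc m) k
... | suc p | m∣p | _ = subst (m ∣_) (cong (p ℕ.+_) (ℕ.*-comm (suc p) m)) (∣m∣n⇒∣m+n m∣p (n∣m*n (suc p)))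

2^m≡1+[2^m∸1] : ∀ m → 2 ^ m ≡ suc (2 ^ m ∸ 1)
2^m≡1+[2^m∸1] m = sym (ℕ.m+[n∸m]≡n (ℕ.m^n>0 2 m))

2^m∸1∣2^n∸1 : ∀ {m n} → m ∣ n → 2 ^ m ∸ 1 ∣ 2 ^ n ∸ 1
2^m∸1∣2^n∸1 {m} {n} (divides q n≡qm) = subst (2 ^ m ∸ 1 ∣_) (sym 2^n∸1≡) (m∣[1+m]^k∸1 _ q)
  where
  2^n∸1≡ : 2 ^ n ∸ 1 ≡ suc (2 ^ m ∸ 1) ^ q ∸ 1
  2^n∸1≡ = cong (_∸ 1) (begin
    2 ^ n           ≡⟨ cong (2 ^_) (trans n≡qm (ℕ.*-comm q m)) ⟩
    2 ^ (m ℕ.* q)   ≡⟨ ℕ.^-*-assoc 2 m q ⟨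
    (2 ^ m) ^ q     ≡⟨ cong (_^ q) (2^m≡1+[2^m∸1] m) ⟩
    _ ∎)
    where open ≡-Reasoning

div'[a,b]*b≡a : ∀ {a b} → 0 < b → b ∣ a → div' a b ℕ.* b ≡ a
div'[a,b]*b≡a {b = suc _} _ b∣a = m/n*n≡m b∣a

Unique-tabulate⁻ : ∀ {A : Set} {n} {f : Fin n → A} → Unique (tabulate f) → ∀ {i j} → f i ≡ f j → i ≡ j
Unique-tabulate⁻ {n = suc n} _            {0F}      {0F}      _  = refl
Unique-tabulate⁻ {n = suc n} (f₀∉ ∷ _)    {0F}      {Fin.suc j} eq = ⊥-elim (All.lookup f₀∉ (∈-tabulate⁺ j) eq)
Unique-tabulate⁻ {n = suc n} (f₀∉ ∷ _)    {Fin.suc i} {0F}      eq = ⊥-elim (All.lookup f₀∉ (∈-tabulate⁺ i) (sym eq))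
Unique-tabulate⁻ {n = suc n} (_ ∷ unique) {Fin.suc i} {Fin.suc j} eq = cong Fin.suc (Unique-tabulate⁻ unique eq)

module _ {N : ℕ} where
  open Extrema (≤-totalOrder N) using (min; min≤xs; argmin-sel)

  min-∈ : ∀ {⊤ : Fin N} {xs} → ⊤ ∈ xs → min ⊤ xs ∈ xs
  min-∈ {⊤} {xs} ⊤∈xs with argmin-sel id ⊤ xs
  ... | inj₁ min≡⊤ = subst (_∈ xs) (sym min≡⊤) ⊤∈xs
  ... | inj₂ min∈xs = min∈xs

  min-cong : ∀ {⊤ ⊤' : Fin N} {xs ys} → ⊤ ∈ xs → ⊤' ∈ ys → (∀ z → (z ∈ xs → z ∈ ys) × (z ∈ ys → z ∈ xs)) →
             min ⊤ xs ≡ min ⊤' ys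
  min-cong {⊤} {⊤'} {xs} {ys} ⊤∈xs ⊤'∈ys xs≐ys = ≤-antisym
    (All.lookup (min≤xs ⊤ xs) (proj₂ (xs≐ys _) (min-∈ ⊤'∈ys)))
    (All.lookup (min≤xs ⊤' ys) (proj₁ (xs≐ys _) (min-∈ ⊤∈xs)))

module TriangleDesigns {n : ℕ} (K : GF2 n) (m : ℕ) where
  open Design K m renaming (_+_ to infixl 6 _+_; _*_ to infixl 7 _*_)
  open IsCommutativeRing isCommutativeRing
    using (+-assoc; +-comm; +-identityˡ; +-identityʳ; *-assoc; *-comm; *-identityˡ; *-identityʳ;
           zeroˡ; zeroʳ; distribˡ; distribʳ; -‿inverseʳ)

  ring : CommutativeRing _ _
  ring = record { isCommutativeRing = isCommutativeRing }
  open Exp (CommutativeRing.commutativeSemiring ring) using (^-homo-*; ^-assocʳ; ^-distrib-*)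
    renaming (_^_ to _^ᴿ_)
  open RingSolver (fromCommutativeRing ring (λ _ → nothing))
  open CommutativeSemigroupProperties (CommutativeRing.*-commutativeSemigroup ring)
    using (x∙yz≈y∙xz; interchange)

  -- Characteristic 2 and powers

  x+x≡0 : ∀ x → x + x ≡ 0#
  x+x≡0 = -‿inverseʳ

  x+[x+y]≡y : ∀ x y → x + (x + y) ≡ y
  x+[x+y]≡y x y = trans (sym (+-assoc x x y)) (trans (cong (_+ y) (x+x≡0 x)) (+-identityˡ y))

  +-cancelˡ : ∀ {x y z} → x + y ≡ x + z → y ≡ z
  +-cancelˡ {x} {y} {z} eq = trans (sym (x+[x+y]≡y x y)) (trans (cong (x +_) eq) (x+[x+y]≡y x z))

  x+y≡0⇒x≡y : ∀ {x y} → x + y ≡ 0# → x ≡ y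
  x+y≡0⇒x≡y {x} {y} eq = +-cancelˡ (trans (+-comm y x) (trans eq (sym (x+x≡0 y))))

  x≢y⇒x+y≢0 : ∀ {x y} → x ≢ y → x + y ≢ 0#
  x≢y⇒x+y≢0 x≢y = x≢y ∘ x+y≡0⇒x≡y

  x≡x+y⇒y≡0 : ∀ {x y} → x ≡ x + y → y ≡ 0#
  x≡x+y⇒y≡0 {x} eq = sym (+-cancelˡ (trans (+-identityʳ x) eq))

  y≡x+y⇒x≡0 : ∀ {x y} → y ≡ x + y → x ≡ 0#
  y≡x+y⇒x≡0 {x} {y} eq = x≡x+y⇒y≡0 (trans eq (+-comm x y))

  +-rotate : ∀ x y z → y + z + x ≡ x + y + z
  +-rotate x y z = trans (+-comm (y + z) x) (sym (+-assoc x y z))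

  ^F≡^ᴿ : ∀ x k → x ^F k ≡ x ^ᴿ k
  ^F≡^ᴿ x zero    = refl
  ^F≡^ᴿ x (suc k) = cong (x *_) (^F≡^ᴿ x k)

  ^F-homo-* : ∀ x a b → x ^F (a ℕ.+ b) ≡ x ^F a * x ^F b
  ^F-homo-* x a b = trans (^F≡^ᴿ x (a ℕ.+ b)) (trans (^-homo-* x a b) (sym (cong₂ _*_ (^F≡^ᴿ x a) (^F≡^ᴿ x b))))

  ^F-assocʳ : ∀ x a b → (x ^F a) ^F b ≡ x ^F (a ℕ.* b)
  ^F-assocʳ x a b = trans (^F≡^ᴿ _ b) (trans (cong (_^ᴿ b) (^F≡^ᴿ x a)) (trans (^-assocʳ x a b) (sym (^F≡^ᴿ x (a ℕ.* b)))))

  ^F-distrib-* : ∀ x y k → (x * y) ^F k ≡ x ^F k * y ^F k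
  ^F-distrib-* x y k = trans (^F≡^ᴿ _ k) (trans (^-distrib-* x y k) (sym (cong₂ _*_ (^F≡^ᴿ x k) (^F≡^ᴿ y k))))

  1^F≡1 : ∀ k → 1# ^F k ≡ 1#
  1^F≡1 zero    = refl
  1^F≡1 (suc k) = trans (*-identityˡ _) (1^F≡1 k)

  [x+y]^2≡x^2+y^2 : ∀ x y → (x + y) ^F 2 ≡ x ^F 2 + y ^F 2
  [x+y]^2≡x^2+y^2 x y = begin
    (x + y) ^F 2                       ≡⟨ x^2≡x*x (x + y) ⟩
    (x + y) * (x + y)                  ≡⟨ expand x y ⟩
    x * x + y * y + (x * y + x * y)    ≡⟨ cong (x * x + y * y +_) (x+x≡0 (x * y)) ⟩
    x * x + y * y + 0#                 ≡⟨ +-identityʳ _ ⟩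
    x * x + y * y                      ≡⟨ cong₂ _+_ (x^2≡x*x x) (x^2≡x*x y) ⟨
    x ^F 2 + y ^F 2                    ∎
    where
    open ≡-Reasoning
    x^2≡x*x : ∀ x → x ^F 2 ≡ x * x
    x^2≡x*x x = cong (x *_) (*-identityʳ x)
    expand : ∀ x y → (x + y) * (x + y) ≡ x * x + y * y + (x * y + x * y)
    expand = solve 2 (λ x y → ((x ⊕ y) ⊗ (x ⊕ y)) ⊜ (x ⊗ x ⊕ y ⊗ y ⊕ (x ⊗ y ⊕ x ⊗ y))) refl

  frobenius : ∀ k x y → (x + y) ^F (2 ^ k) ≡ x ^F (2 ^ k) + y ^F (2 ^ k)
  frobenius zero    x y = distribʳ 1# x y
  frobenius (suc k) x y = begin
    (x + y) ^F (2 ℕ.* 2 ^ k)                    ≡⟨ ^F-assocʳ (x + y) 2 (2 ^ k) ⟨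
    ((x + y) ^F 2) ^F (2 ^ k)                   ≡⟨ cong (_^F (2 ^ k)) ([x+y]^2≡x^2+y^2 x y) ⟩
    (x ^F 2 + y ^F 2) ^F (2 ^ k)                ≡⟨ frobenius k (x ^F 2) (y ^F 2) ⟩
    (x ^F 2) ^F (2 ^ k) + (y ^F 2) ^F (2 ^ k)   ≡⟨ cong₂ _+_ (^F-assocʳ x 2 (2 ^ k)) (^F-assocʳ y 2 (2 ^ k)) ⟩
    x ^F (2 ℕ.* 2 ^ k) + y ^F (2 ℕ.* 2 ^ k)     ∎
    where open ≡-Reasoning

  -- The exponential map i ↦ ξ^i of ℤ_N onto F*

  e : Fin N → F
  e i = ξ ^F toℕ i

  ξ^-periodic : ∀ a q → ξ ^F (a ℕ.+ q ℕ.* N) ≡ ξ ^F a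
  ξ^-periodic a q = begin
    ξ ^F (a ℕ.+ q ℕ.* N)      ≡⟨ ^F-homo-* ξ a (q ℕ.* N) ⟩
    ξ ^F a * ξ ^F (q ℕ.* N)   ≡⟨ cong (λ k → ξ ^F a * ξ ^F k) (ℕ.*-comm q N) ⟩
    ξ ^F a * ξ ^F (N ℕ.* q)   ≡⟨ cong (ξ ^F a *_) (^F-assocʳ ξ N q) ⟨
    ξ ^F a * (ξ ^F N) ^F q    ≡⟨ cong (λ z → ξ ^F a * z ^F q) ξ^N≡1 ⟩
    ξ ^F a * 1# ^F q          ≡⟨ cong (ξ ^F a *_) (1^F≡1 q) ⟩
    ξ ^F a * 1#               ≡⟨ *-identityʳ _ ⟩
    ξ ^F a                    ∎
    where open ≡-Reasoning

  e-residue : ∀ {i x} → Residue i x → e i ≡ ξ ^F x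
  e-residue {i} (q , refl) = sym (ξ^-periodic (toℕ i) q)

  e-addZ : ∀ i j → e (addZ i j) ≡ e i * e j
  e-addZ i j = trans (e-residue (addZ-residue i j)) (^F-homo-* ξ (toℕ i) (toℕ j))

  e-negZ : ∀ i → e (negZ i) * e i ≡ 1#
  e-negZ i = begin
    e (negZ i) * e i              ≡⟨ cong (_* e i) (e-residue (negZ-residue i)) ⟩
    ξ ^F (N ∸ toℕ i) * e i        ≡⟨ ^F-homo-* ξ (N ∸ toℕ i) (toℕ i) ⟨
    ξ ^F (N ∸ toℕ i ℕ.+ toℕ i)    ≡⟨ cong (ξ ^F_) (ℕ.m∸n+n≡m (ℕ.<⇒≤ (toℕ<n i))) ⟩
    ξ ^F N                        ≡⟨ ξ^N≡1 ⟩
    1#                            ∎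
    where open ≡-Reasoning

  e-log : ∀ {x} → x ≢ 0# → e (log x) ≡ x
  e-log {x} = ξ^log x

  e-injective : ∀ {i j} → e i ≡ e j → i ≡ j
  e-injective = ξ-inj _ _

  e≢0 : ∀ i → e i ≢ 0#
  e≢0 i eq = 1≢0 (trans (sym (e-negZ i)) (trans (cong (e (negZ i) *_) eq) (zeroʳ _)))

  0<N : 0 < N
  0<N = ℕ.≤-<-trans ℕ.z≤n (toℕ<n (log 1#))

  0<n : 0 < n
  0<n = ℕ.n≢0⇒n>0 λ n≡0 → ℕ.<-irrefl refl (subst (λ k → 0 < 2 ^ k ∸ 1) n≡0 0<N)

  ξ^a≡1⇒a≡0 : ∀ a → a < N → ξ ^F a ≡ 1# → a ≡ 0
  ξ^a≡1⇒a≡0 a a<N ξ^a≡1 =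
    trans (sym (toℕ-fromℕ< a<N)) (trans (cong toℕ (e-injective e[a]≡e[0])) (toℕ-fromℕ< 0<N))
    where
    e[a]≡e[0] : e (fromℕ< a<N) ≡ e (fromℕ< 0<N)
    e[a]≡e[0] = trans (cong (ξ ^F_) (toℕ-fromℕ< a<N)) (trans ξ^a≡1 (cong (ξ ^F_) (sym (toℕ-fromℕ< 0<N))))

  e≡1⇒toℕ≡0 : ∀ i → e i ≡ 1# → toℕ i ≡ 0
  e≡1⇒toℕ≡0 i = ξ^a≡1⇒a≡0 (toℕ i) (toℕ<n i)

  ξ^a≡1⇒N∣a : ∀ a → ξ ^F a ≡ 1# → N ∣ a
  ξ^a≡1⇒N∣a a ξ^a≡1 = m%n≡0⇒n∣m a N (ξ^a≡1⇒a≡0 (a % N) (m%n<n a N) (begin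
    ξ ^F (a % N)                    ≡⟨ ξ^-periodic (a % N) (a / N) ⟨
    ξ ^F (a % N ℕ.+ a / N ℕ.* N)    ≡⟨ cong (ξ ^F_) (m≡m%n+[m/n]*n a N) ⟨
    ξ ^F a                          ≡⟨ ξ^a≡1 ⟩
    1#                              ∎))
    where
    open ≡-Reasoning
    instance _ = ℕ.>-nonZero 0<N

  e-Zech : ∀ k → e k ≢ 1# → e (Zech k) ≡ 1# + e k
  e-Zech k e[k]≢1 = e-log (λ 1+e[k]≡0 → e[k]≢1 (sym (x+y≡0⇒x≡y 1+e[k]≡0)))

  inv : F → F
  inv x = e (negZ (log x))

  inv-l : ∀ {x} → x ≢ 0# → inv x * x ≡ 1#
  inv-l {x} x≢0 = trans (cong (inv x *_) (sym (e-log x≢0))) (e-negZ (log x))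

  inv-r : ∀ {x} → x ≢ 0# → x * inv x ≡ 1#
  inv-r x≢0 = trans (*-comm _ _) (inv-l x≢0)

  inv≢0 : ∀ x → inv x ≢ 0#
  inv≢0 x = e≢0 (negZ (log x))

  inv-cancelˡ : ∀ {a} → a ≢ 0# → ∀ x → inv a * (a * x) ≡ x
  inv-cancelˡ {a} a≢0 x = trans (sym (*-assoc (inv a) a x)) (trans (cong (_* x) (inv-l a≢0)) (*-identityˡ x))

  *-cancelˡ : ∀ {a x y} → a ≢ 0# → a * x ≡ a * y → x ≡ y
  *-cancelˡ {a} {x} {y} a≢0 eq = trans (sym (inv-cancelˡ a≢0 x)) (trans (cong (inv a *_) eq) (inv-cancelˡ a≢0 y))

  *-cancelʳ : ∀ {a x y} → a ≢ 0# → x * a ≡ y * a → x ≡ y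
  *-cancelʳ {a} {x} {y} a≢0 eq = *-cancelˡ a≢0 (trans (*-comm a x) (trans eq (*-comm y a)))

  x*y≢0 : ∀ {x y} → x ≢ 0# → y ≢ 0# → x * y ≢ 0#
  x*y≢0 {x} {y} x≢0 y≢0 xy≡0 = x≢0 (*-cancelʳ y≢0 (trans xy≡0 (sym (zeroˡ y))))

  δ*x≡x⇒δ≡1 : ∀ {δ x} → x ≢ 0# → δ * x ≡ x → δ ≡ 1#
  δ*x≡x⇒δ≡1 {δ} {x} x≢0 eq = *-cancelʳ x≢0 (trans eq (sym (*-identityˡ x)))

  b*a*inv[a]≡b : ∀ {a} → a ≢ 0# → ∀ b → b * a * inv a ≡ b
  b*a*inv[a]≡b {a} a≢0 b = trans (*-assoc b a (inv a)) (trans (cong (b *_) (inv-r a≢0)) (*-identityʳ b))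

  b*inv[a]*a≡b : ∀ {a} → a ≢ 0# → ∀ b → b * inv a * a ≡ b
  b*inv[a]*a≡b {a} a≢0 b = trans (*-assoc b (inv a) a) (trans (cong (b *_) (inv-l a≢0)) (*-identityʳ b))

  log-ratio : ∀ {a b} → Indep2 a b → e (log (b * inv a)) * a ≡ b
  log-ratio {a} {b} (a≢0 , b≢0 , _) = trans (cong (_* a) (e-log (x*y≢0 b≢0 (inv≢0 a)))) (b*inv[a]*a≡b a≢0 b)

  Subfield-0 : Subfield 0#
  Subfield-0 = trans (cong (0# ^F_) (2^m≡1+[2^m∸1] m)) (zeroˡ _)

  Subfield-1 : Subfield 1#
  Subfield-1 = 1^F≡1 (2 ^ m)

  Subfield-* : ∀ {x y} → Subfield x → Subfield y → Subfield (x * y)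
  Subfield-* {x} {y} x∈ y∈ = trans (^F-distrib-* x y (2 ^ m)) (cong₂ _*_ x∈ y∈)

  Subfield-+ : ∀ {x y} → Subfield x → Subfield y → Subfield (x + y)
  Subfield-+ {x} {y} x∈ y∈ = trans (frobenius m x y) (cong₂ _+_ x∈ y∈)

  Subfield-inv : ∀ {x y} → x * y ≡ 1# → Subfield x → Subfield y
  Subfield-inv {x} {y} xy≡1 x∈ = *-cancelˡ x≢0 (begin
    x * y ^F (2 ^ m)              ≡⟨ cong (_* y ^F (2 ^ m)) x∈ ⟨
    x ^F (2 ^ m) * y ^F (2 ^ m)   ≡⟨ ^F-distrib-* x y (2 ^ m) ⟨
    (x * y) ^F (2 ^ m)            ≡⟨ cong (_^F (2 ^ m)) xy≡1 ⟩
    1# ^F (2 ^ m)                 ≡⟨ 1^F≡1 (2 ^ m) ⟩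
    1#                            ≡⟨ xy≡1 ⟨
    x * y                         ∎)
    where
    open ≡-Reasoning
    x≢0 : x ≢ 0#
    x≢0 refl = 1≢0 (trans (sym xy≡1) (zeroˡ y))

  -- Lines and the sets Γ(k)

  SameSet-refl : ∀ {S : F → Set} → SameSet S S
  SameSet-refl x = id , id

  SameSet-sym : ∀ {S T : F → Set} → SameSet S T → SameSet T S
  SameSet-sym S≐T x = proj₂ (S≐T x) , proj₁ (S≐T x)

  SameSet-trans : ∀ {S T U : F → Set} → SameSet S T → SameSet T U → SameSet S U
  SameSet-trans S≐T T≐U x = proj₁ (T≐U x) ∘ proj₁ (S≐T x) , proj₂ (S≐T x) ∘ proj₂ (T≐U x)

  Span-cong : ∀ {a a' b b'} → a ≡ a' → b ≡ b' → SameSet (Span a b) (Span a' b')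
  Span-cong refl refl = SameSet-refl

  Span-a : ∀ {a b} → Span a b a
  Span-a = inj₂ (inj₁ refl)

  Span-b : ∀ {a b} → Span a b b
  Span-b = inj₂ (inj₂ (inj₁ refl))

  Span-swap : ∀ a b → SameSet (Span a b) (Span b a)
  Span-swap a b x = swap a b , swap b a
    where
    swap : ∀ a b → Span a b x → Span b a x
    swap a b (inj₁ x≡0)                 = inj₁ x≡0
    swap a b (inj₂ (inj₁ x≡a))          = inj₂ (inj₂ (inj₁ x≡a))
    swap a b (inj₂ (inj₂ (inj₁ x≡b)))   = inj₂ (inj₁ x≡b)
    swap a b (inj₂ (inj₂ (inj₂ x≡a+b))) = inj₂ (inj₂ (inj₂ (trans x≡a+b (+-comm a b))))

  Span-+ˡ : ∀ a b → SameSet (Span a (a + b)) (Span a b)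
  Span-+ˡ a b x = to , from
    where
    to : Span a (a + b) x → Span a b x
    to (inj₁ x≡0)                  = inj₁ x≡0
    to (inj₂ (inj₁ x≡a))           = inj₂ (inj₁ x≡a)
    to (inj₂ (inj₂ (inj₁ x≡a+b)))  = inj₂ (inj₂ (inj₂ x≡a+b))
    to (inj₂ (inj₂ (inj₂ x≡a+a+b))) = inj₂ (inj₂ (inj₁ (trans x≡a+a+b (x+[x+y]≡y a b))))
    from : Span a b x → Span a (a + b) x
    from (inj₁ x≡0)                 = inj₁ x≡0
    from (inj₂ (inj₁ x≡a))          = inj₂ (inj₁ x≡a)
    from (inj₂ (inj₂ (inj₁ x≡b)))   = inj₂ (inj₂ (inj₂ (trans x≡b (sym (x+[x+y]≡y a b)))))
    from (inj₂ (inj₂ (inj₂ x≡a+b))) = inj₂ (inj₂ (inj₁ x≡a+b))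

  Span-+ʳ : ∀ c d → SameSet (Span d (c + d)) (Span c d)
  Span-+ʳ c d = SameSet-trans (Span-cong refl (+-comm c d)) (SameSet-trans (Span-+ˡ d c) (Span-swap d c))

  Span-*⁺ : ∀ {a b x} d → Span a b x → Span (d * a) (d * b) (d * x)
  Span-*⁺ d (inj₁ refl)                 = inj₁ (zeroʳ d)
  Span-*⁺ d (inj₂ (inj₁ refl))          = Span-a
  Span-*⁺ d (inj₂ (inj₂ (inj₁ refl)))   = Span-b
  Span-*⁺ d (inj₂ (inj₂ (inj₂ refl)))   = inj₂ (inj₂ (inj₂ (distribˡ d _ _)))

  Span-*⁻ : ∀ {a b y} d → Span (d * a) (d * b) y → ∃ λ x → Span a b x × y ≡ d * x
  Span-*⁻ {a} {b} d (inj₁ refl)               = 0# , inj₁ refl , sym (zeroʳ d)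
  Span-*⁻ {a} {b} d (inj₂ (inj₁ refl))        = a , Span-a , refl
  Span-*⁻ {a} {b} d (inj₂ (inj₂ (inj₁ refl))) = b , Span-b , refl
  Span-*⁻ {a} {b} d (inj₂ (inj₂ (inj₂ refl))) = a + b , inj₂ (inj₂ (inj₂ refl)) , sym (distribˡ d a b)

  Span-*-cancel : ∀ {a b x d} → d ≢ 0# → Span (d * a) (d * b) (d * x) → Span a b x
  Span-*-cancel d≢0 dx∈ with Span-*⁻ _ dx∈
  ... | x' , x'∈ , dx≡dx' = subst (Span _ _) (sym (*-cancelˡ d≢0 dx≡dx')) x'∈

  SameSet-Span-* : ∀ {a b a' b'} d → SameSet (Span a b) (Span a' b') →
                   SameSet (Span (d * a) (d * b)) (Span (d * a') (d * b'))
  SameSet-Span-* d S≐T y = transport S≐T , transport (SameSet-sym S≐T)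
    where
    transport : ∀ {a b a' b'} → SameSet (Span a b) (Span a' b') → Span (d * a) (d * b) y → Span (d * a') (d * b') y
    transport S≐T y∈ with Span-*⁻ d y∈
    ... | x , x∈ , refl = Span-*⁺ d (proj₁ (S≐T x) x∈)

  point : F → F → Fin 3 → F
  point c d 0F = c
  point c d 1F = d
  point c d 2F = c + d

  -- j indexes the ordered pairs of distinct points among c, d, c + d, in the order in which
  -- Γ lists their ratios (Γ-ratio).
  source target : Fin 6 → Fin 3
  source 0F = 0F
  source 1F = 0F
  source 2F = 1F
  source 3F = 2F
  source 4F = 2F
  source 5F = 1F
  target 0F = 1F
  target 1F = 2F
  target 2F = 2F
  target 3F = 1F
  target 4F = 0F
  target 5F = 0F

  pairIndex : Fin 3 → Fin 3 → Fin 6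
  pairIndex 0F 1F = 0F
  pairIndex 0F 2F = 1F
  pairIndex 1F 2F = 2F
  pairIndex 2F 1F = 3F
  pairIndex 2F 0F = 4F
  pairIndex 1F 0F = 5F
  pairIndex _  _  = 0F  -- i = i': junk

  pairIndex-source-target : ∀ j → pairIndex (source j) (target j) ≡ j
  pairIndex-source-target 0F = refl
  pairIndex-source-target 1F = refl
  pairIndex-source-target 2F = refl
  pairIndex-source-target 3F = refl
  pairIndex-source-target 4F = refl
  pairIndex-source-target 5F = refl

  source-target-pairIndex : ∀ i i' → i ≢ i' → source (pairIndex i i') ≡ i × target (pairIndex i i') ≡ i'
  source-target-pairIndex 0F 0F i≢i' = ⊥-elim (i≢i' refl)
  source-target-pairIndex 0F 1F _    = refl , refl
  source-target-pairIndex 0F 2F _    = refl , refl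
  source-target-pairIndex 1F 0F _    = refl , refl
  source-target-pairIndex 1F 1F i≢i' = ⊥-elim (i≢i' refl)
  source-target-pairIndex 1F 2F _    = refl , refl
  source-target-pairIndex 2F 0F _    = refl , refl
  source-target-pairIndex 2F 1F _    = refl , refl
  source-target-pairIndex 2F 2F i≢i' = ⊥-elim (i≢i' refl)

  pair-injective : ∀ {j j'} → source j ≡ source j' → target j ≡ target j' → j ≡ j'
  pair-injective {j} {j'} s≡s' t≡t' =
    trans (sym (pairIndex-source-target j)) (trans (cong₂ pairIndex s≡s' t≡t') (pairIndex-source-target j'))

  source≢target : ∀ j → source j ≢ target j
  source≢target 0F ()
  source≢target 1F ()
  source≢target 2F ()
  source≢target 3F ()
  source≢target 4F ()
  source≢target 5F ()

  point≢0 : ∀ {c d} → Indep2 c d → ∀ i → point c d i ≢ 0#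
  point≢0 (c≢0 , d≢0 , c≢d) 0F = c≢0
  point≢0 (c≢0 , d≢0 , c≢d) 1F = d≢0
  point≢0 (c≢0 , d≢0 , c≢d) 2F = x≢y⇒x+y≢0 c≢d

  point-injective : ∀ {c d} → Indep2 c d → ∀ {i i'} → point c d i ≡ point c d i' → i ≡ i'
  point-injective _                 {0F} {0F} _  = refl
  point-injective (c≢0 , d≢0 , c≢d) {0F} {1F} eq = ⊥-elim (c≢d eq)
  point-injective (c≢0 , d≢0 , c≢d) {0F} {2F} eq = ⊥-elim (d≢0 (x≡x+y⇒y≡0 eq))
  point-injective (c≢0 , d≢0 , c≢d) {1F} {0F} eq = ⊥-elim (c≢d (sym eq))
  point-injective _                 {1F} {1F} _  = refl
  point-injective (c≢0 , d≢0 , c≢d) {1F} {2F} eq = ⊥-elim (c≢0 (y≡x+y⇒x≡0 eq))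
  point-injective (c≢0 , d≢0 , c≢d) {2F} {0F} eq = ⊥-elim (d≢0 (x≡x+y⇒y≡0 (sym eq)))
  point-injective (c≢0 , d≢0 , c≢d) {2F} {1F} eq = ⊥-elim (c≢0 (y≡x+y⇒x≡0 (sym eq)))
  point-injective _                 {2F} {2F} _  = refl

  Span⇒point : ∀ {c d x} → Span c d x → x ≢ 0# → ∃ λ i → x ≡ point c d i
  Span⇒point (inj₁ x≡0)                 x≢0 = ⊥-elim (x≢0 x≡0)
  Span⇒point (inj₂ (inj₁ x≡c))          _   = 0F , x≡c
  Span⇒point (inj₂ (inj₂ (inj₁ x≡d)))   _   = 1F , x≡d
  Span⇒point (inj₂ (inj₂ (inj₂ x≡c+d))) _   = 2F , x≡c+d

  point∈Span : ∀ c d i → Span c d (point c d i)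
  point∈Span c d 0F = Span-a
  point∈Span c d 1F = Span-b
  point∈Span c d 2F = inj₂ (inj₂ (inj₂ refl))

  Span⇒pair : ∀ {c d x y} → Span c d x → Span c d y → x ≢ 0# → y ≢ 0# → x ≢ y →
              ∃ λ j → x ≡ point c d (source j) × y ≡ point c d (target j)
  Span⇒pair {c} {d} x∈ y∈ x≢0 y≢0 x≢y with Span⇒point x∈ x≢0 | Span⇒point y∈ y≢0
  ... | i , refl | i' , refl with source-target-pairIndex i i' (x≢y ∘ cong (point c d))
  ...   | s≡i , t≡i' = pairIndex i i' , cong (point c d) (sym s≡i) , cong (point c d) (sym t≡i')

  pair-Span : ∀ j c d → SameSet (Span (point c d (source j)) (point c d (target j))) (Span c d)
  pair-Span 0F c d = SameSet-refl
  pair-Span 1F c d = Span-+ˡ c d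
  pair-Span 2F c d = Span-+ʳ c d
  pair-Span 3F c d = SameSet-trans (Span-swap (c + d) d) (Span-+ʳ c d)
  pair-Span 4F c d = SameSet-trans (Span-swap (c + d) c) (Span-+ˡ c d)
  pair-Span 5F c d = Span-swap d c

  Γ-at : Fin N → Fin 6 → Fin N
  Γ-at k 0F = k
  Γ-at k 1F = Zech k
  Γ-at k 2F = Zech (negZ k)
  Γ-at k 3F = negZ (Zech (negZ k))
  Γ-at k 4F = negZ (Zech k)
  Γ-at k 5F = negZ k

  ratio-inverse : ∀ {r u w s} → r * u ≡ w → s * r ≡ 1# → s * w ≡ u
  ratio-inverse {r} {u} {w} {s} r*u≡w s*r≡1 =
    trans (cong (s *_) (sym r*u≡w)) (trans (sym (*-assoc s r u)) (trans (cong (_* u) s*r≡1) (*-identityˡ u)))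

  e[-k]≢1 : ∀ {k} → e k ≢ 1# → e (negZ k) ≢ 1#
  e[-k]≢1 {k} e[k]≢1 e[-k]≡1 = e[k]≢1 (trans (sym (*-identityˡ (e k))) (trans (cong (_* e k) (sym e[-k]≡1)) (e-negZ k)))

  ratio≢1 : ∀ {c d k} → Indep2 c d → d ≡ e k * c → e k ≢ 1#
  ratio≢1 {c} (_ , _ , c≢d) d≡kc e[k]≡1 = c≢d (sym (trans d≡kc (trans (cong (_* c) e[k]≡1) (*-identityˡ c))))

  Γ-ratio : ∀ {k c d} → e k ≢ 1# → d ≡ e k * c →
            ∀ j → e (Γ-at k j) * point c d (source j) ≡ point c d (target j)
  Γ-ratio {k} {c} {d} e[k]≢1 d≡kc = ratio
    where
    ratio₀ : e k * c ≡ d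
    ratio₀ = sym d≡kc
    ratio₅ : e (negZ k) * d ≡ c
    ratio₅ = ratio-inverse ratio₀ (e-negZ k)
    ratio₁ : e (Zech k) * c ≡ c + d
    ratio₁ = trans (cong (_* c) (e-Zech k e[k]≢1)) (trans (distribʳ c 1# (e k)) (cong₂ _+_ (*-identityˡ c) ratio₀))
    ratio₂ : e (Zech (negZ k)) * d ≡ c + d
    ratio₂ = trans (cong (_* d) (e-Zech (negZ k) (e[-k]≢1 e[k]≢1)))
                   (trans (distribʳ d 1# (e (negZ k))) (trans (cong₂ _+_ (*-identityˡ d) ratio₅) (+-comm d c)))
    ratio : ∀ j → e (Γ-at k j) * point c d (source j) ≡ point c d (target j)
    ratio 0F = ratio₀
    ratio 1F = ratio₁
    ratio 2F = ratio₂
    ratio 3F = ratio-inverse ratio₂ (e-negZ (Zech (negZ k)))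
    ratio 4F = ratio-inverse ratio₁ (e-negZ (Zech k))
    ratio 5F = ratio₅

  ratio∈Γ : ∀ {a b c d k} x → Indep2 a b → Indep2 c d → d ≡ e k * c → e x * a ≡ b →
            SameSet (Span a b) (Span c d) → ∃ λ j → x ≡ Γ-at k j
  ratio∈Γ {a} {b} {c} {d} {k} x (a≢0 , b≢0 , a≢b) cd d≡kc x-ratio ab≐cd
    with Span⇒pair (proj₁ (ab≐cd a) Span-a) (proj₁ (ab≐cd b) Span-b) a≢0 b≢0 a≢b
  ... | j , a≡ , b≡ = j , e-injective (*-cancelʳ a≢0 (begin
    e x * a                                    ≡⟨ x-ratio ⟩
    b                                          ≡⟨ b≡ ⟩
    point c d (target j)                       ≡⟨ Γ-ratio (ratio≢1 {k = k} cd d≡kc) d≡kc j ⟨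
    e (Γ-at k j) * point c d (source j)        ≡⟨ cong (e (Γ-at k j) *_) a≡ ⟨
    e (Γ-at k j) * a                           ∎))
    where open ≡-Reasoning

  Γ-line : ∀ {a c d k} → Indep2 c d → d ≡ e k * c → ∀ j → a ≢ 0# →
           ∃ λ γ → γ ≢ 0# × SameSet (Span a (e (Γ-at k j) * a)) (Span (γ * c) (γ * d))
  Γ-line {a} {c} {d} {k} cd d≡kc j a≢0 =
    γ , x*y≢0 a≢0 (inv≢0 u) , SameSet-trans (Span-cong (sym γu≡a) (sym γw≡ra)) (SameSet-Span-* γ (pair-Span j c d))
    where
    u = point c d (source j)
    w = point c d (target j)
    r = e (Γ-at k j)
    γ = a * inv u
    γu≡a : γ * u ≡ a
    γu≡a = b*inv[a]*a≡b (point≢0 cd (source j)) a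
    γw≡ra : γ * w ≡ r * a
    γw≡ra = trans (cong (γ *_) (sym (Γ-ratio (ratio≢1 {k = k} cd d≡kc) d≡kc j))) (trans (x∙yz≈y∙xz γ r u) (cong (r *_) γu≡a))

  Span-InGroup : ∀ {a b r} → Subfield r → r * a ≡ b → InGroup (Span a b) a
  Span-InGroup {a} r∈ _    x (inj₁ refl)               = 0# , Subfield-0 , sym (zeroʳ a)
  Span-InGroup {a} r∈ _    x (inj₂ (inj₁ refl))        = 1# , Subfield-1 , sym (*-identityʳ a)
  Span-InGroup {a} {r = r} r∈ refl x (inj₂ (inj₂ (inj₁ refl))) = r , r∈ , *-comm r a
  Span-InGroup {a} {r = r} r∈ refl x (inj₂ (inj₂ (inj₂ refl))) =
    1# + r , Subfield-+ Subfield-1 r∈ , trans (cong₂ _+_ (sym (*-identityʳ a)) (*-comm r a)) (sym (distribˡ a 1# r))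

  InGroup⇒Subfield : ∀ {a b r c} → a ≢ 0# → r * a ≡ b → InGroup (Span a b) c → Subfield r
  InGroup⇒Subfield {a} {b} {r} {c} a≢0 r*a≡b a,b∈cF with a,b∈cF a Span-a | a,b∈cF b Span-b
  ... | s , s∈ , a≡cs | s' , s'∈ , b≡cs' =
    subst Subfield r≡s'/s (Subfield-* s'∈ (Subfield-inv (inv-r s≢0) s∈))
    where
    s≢0 : s ≢ 0#
    s≢0 refl = a≢0 (trans a≡cs (zeroʳ c))
    c≢0 : c ≢ 0#
    c≢0 refl = a≢0 (trans a≡cs (zeroˡ s))
    r*s≡s' : r * s ≡ s'
    r*s≡s' = *-cancelˡ c≢0 (trans (x∙yz≈y∙xz c r s) (trans (cong (r *_) (sym a≡cs)) (trans r*a≡b b≡cs')))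
    r≡s'/s : s' * inv s ≡ r
    r≡s'/s = trans (cong (_* inv s) (sym r*s≡s')) (b*a*inv[a]≡b s≢0 r)

  Group-⊆ : ∀ {a c c'} → a ≢ 0# → Group c a → Group c' a → ∀ x → Group c x → Group c' x
  Group-⊆ {a} {c} {c'} a≢0 (s , s∈ , a≡cs) (s' , s'∈ , a≡c's') x (t , t∈ , x≡ct) =
    s' * inv s * t , Subfield-* (Subfield-* s'∈ (Subfield-inv (inv-r s≢0) s∈)) t∈ , (begin
      x                       ≡⟨ x≡ct ⟩
      c * t                   ≡⟨ cong (_* t) (b*a*inv[a]≡b s≢0 c) ⟨
      c * s * inv s * t       ≡⟨ cong (λ z → z * inv s * t) (trans (sym a≡cs) a≡c's') ⟩
      c' * s' * inv s * t     ≡⟨ trans (*-assoc (c' * s') (inv s) t) (*-assoc c' s' (inv s * t)) ⟩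
      c' * (s' * (inv s * t)) ≡⟨ cong (c' *_) (*-assoc s' (inv s) t) ⟨
      c' * (s' * inv s * t)   ∎)
    where
    open ≡-Reasoning
    s≢0 : s ≢ 0#
    s≢0 refl = a≢0 (trans a≡cs (zeroʳ c))

  InGroup-unique : ∀ {S : F → Set} {a c c'} → a ≢ 0# → S a → InGroup S c → InGroup S c' →
                   SameSet (Group c) (Group c')
  InGroup-unique a≢0 a∈S S⊆cF S⊆c'F x =
    Group-⊆ a≢0 (S⊆cF _ a∈S) (S⊆c'F _ a∈S) x , Group-⊆ a≢0 (S⊆c'F _ a∈S) (S⊆cF _ a∈S) x

  -- Triangles

  Independent : Triple → Set
  Independent (a , b , c) = Indep3 a b c

  corner : Fin 3 → Triple → F
  corner 0F (a , b , c) = a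
  corner 1F (a , b , c) = b
  corner 2F (a , b , c) = c

  next : Fin 3 → Fin 3
  next 0F = 1F
  next 1F = 2F
  next 2F = 0F

  side : Fin 3 → Triple → F → Set
  side s T = Span (corner s T) (corner (next s) T)

  rotate : Triple → Triple
  rotate (a , b , c) = b , c , a

  corner-rotate : ∀ i T → corner i (rotate T) ≡ corner (next i) T
  corner-rotate 0F T = refl
  corner-rotate 1F T = refl
  corner-rotate 2F T = refl

  corner-scaleT : ∀ i d T → corner i (scaleT d T) ≡ d * corner i T
  corner-scaleT 0F d T = refl
  corner-scaleT 1F d T = refl
  corner-scaleT 2F d T = refl

  side-scaleT : ∀ s d T → SameSet (side s (scaleT d T)) (Span (d * corner s T) (d * corner (next s) T))
  side-scaleT s d T = Span-cong (corner-scaleT s d T) (corner-scaleT (next s) d T)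

  Independent-rotate : ∀ {T} → Independent T → Independent (rotate T)
  Independent-rotate {a , b , c} ((a≢0 , b≢0 , a≢b) , c≢0 , c≢a , c≢b , c≢a+b) =
    (b≢0 , c≢0 , c≢b ∘ sym) , a≢0 , a≢b , c≢a ∘ sym , c≢a+b ∘ a≡b+c⇒c≡a+b
    where
    a≡b+c⇒c≡a+b : a ≡ b + c → c ≡ a + b
    a≡b+c⇒c≡a+b eq = trans (sym (x+[x+y]≡y b c)) (trans (+-comm b (b + c)) (cong (_+ b) (sym eq)))

  Independent-scaleT : ∀ {T} d → d ≢ 0# → Independent T → Independent (scaleT d T)
  Independent-scaleT {a , b , c} d d≢0 ((a≢0 , b≢0 , a≢b) , c≢0 , c≢a , c≢b , c≢a+b) =
    (x*y≢0 d≢0 a≢0 , x*y≢0 d≢0 b≢0 , a≢b ∘ *-cancelˡ d≢0) , x*y≢0 d≢0 c≢0 ,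
    c≢a ∘ *-cancelˡ d≢0 , c≢b ∘ *-cancelˡ d≢0 , c≢a+b ∘ *-cancelˡ d≢0 ∘ (λ eq → trans eq (sym (distribˡ d a b)))

  Independent⇒Indep2 : ∀ {T} → Independent T → ∀ s → Indep2 (corner s T) (corner (next s) T)
  Independent⇒Indep2 ind 0F = proj₁ ind
  Independent⇒Indep2 ind 1F = proj₁ (Independent-rotate ind)
  Independent⇒Indep2 ind 2F = proj₁ (Independent-rotate (Independent-rotate ind))

  InTri⇒side : ∀ {S} T → InTri S T → ∃ λ s → SameSet S (side s T)
  InTri⇒side T (inj₁ S≐side)        = 0F , S≐side
  InTri⇒side T (inj₂ (inj₁ S≐side)) = 1F , S≐side
  InTri⇒side T (inj₂ (inj₂ S≐side)) = 2F , S≐side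

  side⇒InTri : ∀ {S} T s → SameSet S (side s T) → InTri S T
  side⇒InTri T 0F S≐side = inj₁ S≐side
  side⇒InTri T 1F S≐side = inj₂ (inj₁ S≐side)
  side⇒InTri T 2F S≐side = inj₂ (inj₂ S≐side)

  InTri-resp : ∀ {S S'} T → SameSet S S' → InTri S' T → InTri S T
  InTri-resp T S≐S' S'∈T with InTri⇒side T S'∈T
  ... | s , S'≐side = side⇒InTri T s (SameSet-trans S≐S' S'≐side)

  SidesIn : Triple → Triple → Set
  SidesIn T T' = ∀ s → InTri (side s T) T'

  SameTri⇒SidesIn : ∀ T T' → SameTri T T' → SidesIn T T' × SidesIn T' T
  SameTri⇒SidesIn T T' ((p₀ , p₁ , p₂) , (q₀ , q₁ , q₂)) = sidesIn p₀ p₁ p₂ , sidesIn q₀ q₁ q₂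
    where
    sidesIn : ∀ {T T'} → InTri (side 0F T) T' → InTri (side 1F T) T' → InTri (side 2F T) T' → SidesIn T T'
    sidesIn p₀ p₁ p₂ 0F = p₀
    sidesIn p₀ p₁ p₂ 1F = p₁
    sidesIn p₀ p₁ p₂ 2F = p₂

  SidesIn⇒SameTri : ∀ T T' → SidesIn T T' → SidesIn T' T → SameTri T T'
  SidesIn⇒SameTri T T' T⊆T' T'⊆T = (T⊆T' 0F , T⊆T' 1F , T⊆T' 2F) , (T'⊆T 0F , T'⊆T 1F , T'⊆T 2F)

  InTri-SidesIn : ∀ {S} T T' → InTri S T → SidesIn T T' → InTri S T'
  InTri-SidesIn T T' S∈T T⊆T' with InTri⇒side T S∈T
  ... | s , S≐side = InTri-resp T' S≐side (T⊆T' s)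

  SidesIn-refl : ∀ T → SidesIn T T
  SidesIn-refl T s = side⇒InTri T s SameSet-refl

  SidesIn-trans : ∀ T₁ T₂ T₃ → SidesIn T₁ T₂ → SidesIn T₂ T₃ → SidesIn T₁ T₃
  SidesIn-trans T₁ T₂ T₃ T₁⊆T₂ T₂⊆T₃ s = InTri-SidesIn T₂ T₃ (T₁⊆T₂ s) T₂⊆T₃

  SameTri-refl : ∀ T → SameTri T T
  SameTri-refl T = SidesIn⇒SameTri T T (SidesIn-refl T) (SidesIn-refl T)

  SameTri-sym : ∀ T T' → SameTri T T' → SameTri T' T
  SameTri-sym T T' T≐T' = SidesIn⇒SameTri T' T (proj₂ (SameTri⇒SidesIn T T' T≐T')) (proj₁ (SameTri⇒SidesIn T T' T≐T'))

  SameTri-trans : ∀ T₁ T₂ T₃ → SameTri T₁ T₂ → SameTri T₂ T₃ → SameTri T₁ T₃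
  SameTri-trans T₁ T₂ T₃ T₁≐T₂ T₂≐T₃ = SidesIn⇒SameTri T₁ T₃
    (SidesIn-trans T₁ T₂ T₃ (proj₁ (SameTri⇒SidesIn T₁ T₂ T₁≐T₂)) (proj₁ (SameTri⇒SidesIn T₂ T₃ T₂≐T₃)))
    (SidesIn-trans T₃ T₂ T₁ (proj₂ (SameTri⇒SidesIn T₂ T₃ T₂≐T₃)) (proj₂ (SameTri⇒SidesIn T₁ T₂ T₁≐T₂)))

  ≡⇒SameTri : ∀ {T T'} → T ≡ T' → SameTri T T'
  ≡⇒SameTri {T} refl = SameTri-refl T

  rotate-SameTri : ∀ T → SameTri (rotate T) T
  rotate-SameTri T = SidesIn⇒SameTri (rotate T) T
    (λ s → side⇒InTri T (next s) (rotated s)) (λ s → side⇒InTri (rotate T) (prev s) (unrotated s))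
    where
    prev : Fin 3 → Fin 3
    prev 0F = 2F
    prev 1F = 0F
    prev 2F = 1F
    rotated : ∀ s → SameSet (side s (rotate T)) (side (next s) T)
    rotated 0F = SameSet-refl
    rotated 1F = SameSet-refl
    rotated 2F = SameSet-refl
    unrotated : ∀ s → SameSet (side s T) (side (prev s) (rotate T))
    unrotated 0F = SameSet-refl
    unrotated 1F = SameSet-refl
    unrotated 2F = SameSet-refl

  InTri-scaleT : ∀ {a b} T d → InTri (Span a b) T → InTri (Span (d * a) (d * b)) (scaleT d T)
  InTri-scaleT T d ab∈T with InTri⇒side T ab∈T
  ... | s , ab≐side = side⇒InTri (scaleT d T) s (SameSet-trans (SameSet-Span-* d ab≐side) (SameSet-sym (side-scaleT s d T)))

  SidesIn-scaleT : ∀ T T' d → SidesIn T T' → SidesIn (scaleT d T) (scaleT d T')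
  SidesIn-scaleT T T' d T⊆T' s = InTri-resp (scaleT d T') (side-scaleT s d T) (InTri-scaleT T' d (T⊆T' s))

  SameTri-scaleT : ∀ T T' d → SameTri T T' → SameTri (scaleT d T) (scaleT d T')
  SameTri-scaleT T T' d T≐T' = SidesIn⇒SameTri _ _
    (SidesIn-scaleT T T' d (proj₁ (SameTri⇒SidesIn T T' T≐T'))) (SidesIn-scaleT T' T d (proj₂ (SameTri⇒SidesIn T T' T≐T')))

  side-scaleT-cong : ∀ {s s' T T'} d → SameSet (side s T) (side s' T') →
                     SameSet (side s (scaleT d T)) (side s' (scaleT d T'))
  side-scaleT-cong {s} {s'} {T} {T'} d s≐s' =
    SameSet-trans (side-scaleT s d T) (SameSet-trans (SameSet-Span-* d s≐s') (SameSet-sym (side-scaleT s' d T')))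

  scaleT-scaleT : ∀ a b T → scaleT a (scaleT b T) ≡ scaleT (a * b) T
  scaleT-scaleT a b (x , y , z) = cong₂ _,_ (sym (*-assoc a b x)) (cong₂ _,_ (sym (*-assoc a b y)) (sym (*-assoc a b z)))

  scaleT-1 : ∀ T → scaleT 1# T ≡ T
  scaleT-1 (x , y , z) = cong₂ _,_ (*-identityˡ x) (cong₂ _,_ (*-identityˡ y) (*-identityˡ z))

  scaleT-inverseˡ : ∀ {d} → d ≢ 0# → ∀ T → scaleT (inv d) (scaleT d T) ≡ T
  scaleT-inverseˡ {d} d≢0 T = trans (scaleT-scaleT (inv d) d T) (trans (cong (λ z → scaleT z T) (inv-l d≢0)) (scaleT-1 T))

  scaleT-inverseʳ : ∀ {d} → d ≢ 0# → ∀ T → scaleT d (scaleT (inv d) T) ≡ T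
  scaleT-inverseʳ {d} d≢0 T = trans (scaleT-scaleT d (inv d) T) (trans (cong (λ z → scaleT z T) (inv-r d≢0)) (scaleT-1 T))

  InTri-rescale : ∀ {S T₁ T₂ γ₁ γ₂ μ} → γ₁ ≢ 0# → SameTri (scaleT γ₁ T₁) (scaleT γ₂ T₂) →
                  InTri S (scaleT μ T₁) → InTri S (scaleT (μ * inv γ₁ * γ₂) T₂)
  InTri-rescale {S} {T₁} {T₂} {γ₁} {γ₂} {μ} γ₁≢0 γ₁T₁≐γ₂T₂ S∈μT₁ =
    InTri-SidesIn (scaleT μ T₁) _ S∈μT₁
      (proj₁ (SameTri⇒SidesIn _ _ (subst₂ SameTri μT₁≡ μγ₂T₂≡ (SameTri-scaleT _ _ δ γ₁T₁≐γ₂T₂))))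
    where
    δ = μ * inv γ₁
    μT₁≡ : scaleT δ (scaleT γ₁ T₁) ≡ scaleT μ T₁
    μT₁≡ = trans (scaleT-scaleT δ γ₁ T₁) (cong (λ z → scaleT z T₁) (b*inv[a]*a≡b γ₁≢0 μ))
    μγ₂T₂≡ : scaleT δ (scaleT γ₂ T₂) ≡ scaleT (δ * γ₂) T₂
    μγ₂T₂≡ = scaleT-scaleT δ γ₂ T₂

  Covers⇒side : ∀ T {x} → Covers T x → ∃ λ s → side s T x
  Covers⇒side T (inj₁ x∈)        = 0F , x∈
  Covers⇒side T (inj₂ (inj₁ x∈)) = 1F , x∈
  Covers⇒side T (inj₂ (inj₂ x∈)) = 2F , x∈

  side⇒Covers : ∀ T {x} s → side s T x → Covers T x
  side⇒Covers T 0F x∈ = inj₁ x∈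
  side⇒Covers T 1F x∈ = inj₂ (inj₁ x∈)
  side⇒Covers T 2F x∈ = inj₂ (inj₂ x∈)

  Covers-SidesIn : ∀ T T' {x} → Covers T x → SidesIn T T' → Covers T' x
  Covers-SidesIn T T' {x} x∈T T⊆T' with Covers⇒side T x∈T
  ... | s , x∈side with InTri⇒side T' (T⊆T' s)
  ...   | s' , side≐side' = side⇒Covers T' s' (proj₁ (side≐side' x) x∈side)

  Covers-scaleT : ∀ T d {x} → Covers T x → Covers (scaleT d T) (d * x)
  Covers-scaleT T d {x} x∈T with Covers⇒side T x∈T
  ... | s , x∈side = side⇒Covers (scaleT d T) s (proj₂ (side-scaleT s d T (d * x)) (Span-*⁺ d x∈side))

  b∉⟨c,a⟩ : ∀ {a b c} → Indep3 a b c → ¬ Span c a b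
  b∉⟨c,a⟩ ((a≢0 , b≢0 , a≢b) , c≢0 , c≢a , c≢b , c≢a+b) (inj₁ b≡0)                 = b≢0 b≡0
  b∉⟨c,a⟩ ((a≢0 , b≢0 , a≢b) , c≢0 , c≢a , c≢b , c≢a+b) (inj₂ (inj₁ b≡c))          = c≢b (sym b≡c)
  b∉⟨c,a⟩ ((a≢0 , b≢0 , a≢b) , c≢0 , c≢a , c≢b , c≢a+b) (inj₂ (inj₂ (inj₁ b≡a)))   = a≢b (sym b≡a)
  b∉⟨c,a⟩ {a} {b} {c} ((a≢0 , b≢0 , a≢b) , c≢0 , c≢a , c≢b , c≢a+b) (inj₂ (inj₂ (inj₂ b≡c+a))) =
    c≢a+b (trans (sym (x+[x+y]≡y a c)) (cong (a +_) (trans (+-comm a c) (sym b≡c+a))))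

  ⟨a,b⟩∩⟨c,a⟩ : ∀ {a b c x} → Indep3 a b c → x ≢ 0# → Span a b x → Span c a x → x ≡ a
  ⟨a,b⟩∩⟨c,a⟩ ind x≢0 (inj₁ x≡0)                 _ = ⊥-elim (x≢0 x≡0)
  ⟨a,b⟩∩⟨c,a⟩ ind x≢0 (inj₂ (inj₁ x≡a))          _ = x≡a
  ⟨a,b⟩∩⟨c,a⟩ ind x≢0 (inj₂ (inj₂ (inj₁ refl)))  x∈⟨c,a⟩ = ⊥-elim (b∉⟨c,a⟩ ind x∈⟨c,a⟩)
  ⟨a,b⟩∩⟨c,a⟩ ind x≢0 (inj₂ (inj₂ (inj₂ _)))     (inj₁ x≡0) = ⊥-elim (x≢0 x≡0)
  ⟨a,b⟩∩⟨c,a⟩ (_ , _ , _ , _ , c≢a+b) _ (inj₂ (inj₂ (inj₂ x≡a+b))) (inj₂ (inj₁ x≡c)) =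
    ⊥-elim (c≢a+b (trans (sym x≡c) x≡a+b))
  ⟨a,b⟩∩⟨c,a⟩ ind x≢0 (inj₂ (inj₂ (inj₂ _)))     (inj₂ (inj₂ (inj₁ x≡a))) = x≡a
  ⟨a,b⟩∩⟨c,a⟩ {a} {b} {c} (_ , _ , _ , c≢b , _) _ (inj₂ (inj₂ (inj₂ x≡a+b))) (inj₂ (inj₂ (inj₂ x≡c+a))) =
    ⊥-elim (c≢b (sym (+-cancelˡ (trans (sym x≡a+b) (trans x≡c+a (+-comm c a))))))

  sharedCorner : Fin 3 → Fin 3 → Fin 3
  sharedCorner 0F 1F = 1F
  sharedCorner 1F 0F = 1F
  sharedCorner 1F 2F = 2F
  sharedCorner 2F 1F = 2F
  sharedCorner 0F 2F = 0F
  sharedCorner 2F 0F = 0F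
  sharedCorner s  _  = s  -- s = s': junk

  sides-meet : ∀ {T x} → Independent T → ∀ {p q} → p ≢ q → x ≢ 0# → side p T x → side q T x →
               x ≡ corner (sharedCorner p q) T
  sides-meet ind {0F} {0F} p≢q = ⊥-elim (p≢q refl)
  sides-meet ind {0F} {1F} _ x≢0 x∈p x∈q = ⟨a,b⟩∩⟨c,a⟩ (Independent-rotate ind) x≢0 x∈q x∈p
  sides-meet ind {0F} {2F} _ x≢0 x∈p x∈q = ⟨a,b⟩∩⟨c,a⟩ ind x≢0 x∈p x∈q
  sides-meet ind {1F} {0F} _ x≢0 x∈p x∈q = ⟨a,b⟩∩⟨c,a⟩ (Independent-rotate ind) x≢0 x∈p x∈q
  sides-meet ind {1F} {1F} p≢q = ⊥-elim (p≢q refl)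
  sides-meet ind {1F} {2F} _ x≢0 x∈p x∈q = ⟨a,b⟩∩⟨c,a⟩ (Independent-rotate (Independent-rotate ind)) x≢0 x∈q x∈p
  sides-meet ind {2F} {0F} _ x≢0 x∈p x∈q = ⟨a,b⟩∩⟨c,a⟩ ind x≢0 x∈q x∈p
  sides-meet ind {2F} {1F} _ x≢0 x∈p x∈q = ⟨a,b⟩∩⟨c,a⟩ (Independent-rotate (Independent-rotate ind)) x≢0 x∈p x∈q
  sides-meet ind {2F} {2F} p≢q = ⊥-elim (p≢q refl)

  side-determined : ∀ {T x y} → Independent T → x ≢ 0# → y ≢ 0# → x ≢ y → ∀ {s s'} →
                    side s T x → side s T y → side s' T x → side s' T y → s ≡ s'
  side-determined ind x≢0 y≢0 x≢y {s} {s'} x∈s y∈s x∈s' y∈s' with s Fin.≟ s'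
  ... | yes s≡s' = s≡s'
  ... | no s≢s'  = ⊥-elim (x≢y (trans (sides-meet ind s≢s' x≢0 x∈s x∈s') (sym (sides-meet ind s≢s' y≢0 y∈s y∈s'))))

  first second : Triple → Fin 3 × Fin 6 → F
  first  T (s , j) = point (corner s T) (corner (next s) T) (source j)
  second T (s , j) = point (corner s T) (corner (next s) T) (target j)

  first≢0 : ∀ {T} → Independent T → ∀ p → first T p ≢ 0#
  first≢0 ind (s , j) = point≢0 (Independent⇒Indep2 ind s) (source j)

  pair-side : ∀ T p → SameSet (Span (first T p) (second T p)) (side (proj₁ p) T)
  pair-side T (s , j) = pair-Span j (corner s T) (corner (next s) T)

  pair-determined : ∀ {T} → Independent T → ∀ {p q} → first T p ≡ first T q → second T p ≡ second T q → p ≡ q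
  pair-determined {T} ind {s , j} {s' , j'} first≡ second≡ = same-side (side-determined ind u≢0 w≢0 u≢w
    (point∈Span _ _ (source j)) (point∈Span _ _ (target j))
    (subst (side s' T) (sym first≡) (point∈Span _ _ (source j'))) (subst (side s' T) (sym second≡) (point∈Span _ _ (target j'))))
    where
    side-s = Independent⇒Indep2 ind s
    u≢0 = point≢0 side-s (source j)
    w≢0 = point≢0 side-s (target j)
    u≢w = source≢target j ∘ point-injective side-s
    same-side : s ≡ s' → (s , j) ≡ (s' , j')
    same-side refl = cong (s ,_) (pair-injective (point-injective side-s first≡) (point-injective side-s second≡))

  corner₀-image : ∀ {T δ} → Independent T → δ ≢ 0# → SameTri (scaleT δ T) T →
                  ∃ λ i → δ * corner 0F T ≡ corner i T
  corner₀-image {T} {δ} ind δ≢0 δT≐T = image (InTri⇒side T (δT⊆T 0F)) (InTri⇒side T (δT⊆T 2F))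
    where
    δT⊆T = proj₁ (SameTri⇒SidesIn (scaleT δ T) T δT≐T)
    image : (∃ λ p → SameSet (side 0F (scaleT δ T)) (side p T)) →
            (∃ λ q → SameSet (side 2F (scaleT δ T)) (side q T)) → ∃ λ i → δ * corner 0F T ≡ corner i T
    image (p , δab≐p) (q , δca≐q) with p Fin.≟ q
    ... | yes refl = ⊥-elim (b∉⟨c,a⟩ ind (Span-*-cancel δ≢0 (proj₂ (δca≐q _) (proj₁ (δab≐p _) Span-b))))
    ... | no p≢q   = sharedCorner p q , sides-meet ind p≢q (x*y≢0 δ≢0 (proj₁ (proj₁ ind)))
                                    (proj₁ (δab≐p _) Span-a) (proj₁ (δca≐q _) Span-b)

  rotate-stable : ∀ {T δ} → SameTri (scaleT δ T) T → SameTri (scaleT δ (rotate T)) (rotate T)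
  rotate-stable {T} {δ} δT≐T = SameTri-trans (rotate (scaleT δ T)) (scaleT δ T) (rotate T) (rotate-SameTri (scaleT δ T))
                                 (SameTri-trans (scaleT δ T) T (rotate T) δT≐T (SameTri-sym (rotate T) T (rotate-SameTri T)))

  corner-image-rotate : ∀ {T δ} s → (∃ λ i → δ * corner s (rotate T) ≡ corner i (rotate T)) →
                        ∃ λ i → δ * corner (next s) T ≡ corner i T
  corner-image-rotate {T} {δ} s (i , eq) = next i , trans (cong (δ *_) (sym (corner-rotate s T))) (trans eq (corner-rotate i T))

  corner-image : ∀ {T δ} → Independent T → δ ≢ 0# → SameTri (scaleT δ T) T →
                 ∀ s → ∃ λ i → δ * corner s T ≡ corner i T
  corner-image ind δ≢0 δT≐T 0F = corner₀-image ind δ≢0 δT≐T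
  corner-image {T} {δ} ind δ≢0 δT≐T 1F =
    corner-image-rotate 0F (corner₀-image {rotate T} (Independent-rotate ind) δ≢0 (rotate-stable δT≐T))
  corner-image {T} {δ} ind δ≢0 δT≐T 2F =
    corner-image-rotate 1F (corner-image-rotate {rotate T} 0F
      (corner₀-image {rotate (rotate T)} (Independent-rotate (Independent-rotate ind)) δ≢0 (rotate-stable (rotate-stable δT≐T))))

  -- δ permutes the corners: a fixed corner forces δ = 1, a 3-cycle fixes the nonzero sum
  -- a + b + c, and any other map sends two corners to the same one.
  scaleT-stabiliser : ∀ {T δ} → Independent T → δ ≢ 0# → SameTri (scaleT δ T) T → δ ≡ 1#
  scaleT-stabiliser {a , b , c} {δ} ind@((a≢0 , b≢0 , a≢b) , c≢0 , c≢a , c≢b , c≢a+b) δ≢0 δT≐T =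
    permutation (image 0F) (image 1F) (image 2F)
    where
    image = corner-image ind δ≢0 δT≐T
    collide : ∀ {x y z} → δ * x ≡ z → δ * y ≡ z → x ≡ y
    collide δx≡z δy≡z = *-cancelˡ δ≢0 (trans δx≡z (sym δy≡z))
    sum-fixed : δ * a + δ * b + δ * c ≡ a + b + c → δ ≡ 1#
    sum-fixed eq = δ*x≡x⇒δ≡1 (c≢a+b ∘ sym ∘ x+y≡0⇒x≡y)
      (trans (distribˡ δ (a + b) c) (trans (cong (_+ δ * c) (distribˡ δ a b)) eq))
    permutation : (∃ λ i → δ * a ≡ corner i (a , b , c)) → (∃ λ i → δ * b ≡ corner i (a , b , c)) →
                  (∃ λ i → δ * c ≡ corner i (a , b , c)) → δ ≡ 1#
    permutation (0F , δa≡a) _ _ = δ*x≡x⇒δ≡1 a≢0 δa≡a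
    permutation _ (1F , δb≡b) _ = δ*x≡x⇒δ≡1 b≢0 δb≡b
    permutation _ _ (2F , δc≡c) = δ*x≡x⇒δ≡1 c≢0 δc≡c
    permutation (1F , δa≡b) (2F , δb≡c) (0F , δc≡a) = sum-fixed (trans (cong₂ _+_ (cong₂ _+_ δa≡b δb≡c) δc≡a) (+-rotate a b c))
    permutation (2F , δa≡c) (0F , δb≡a) (1F , δc≡b) =
      sum-fixed (trans (cong₂ _+_ (cong₂ _+_ δa≡c δb≡a) δc≡b) (trans (+-rotate b c a) (+-rotate a b c)))
    permutation (1F , δa≡b) (0F , δb≡a) (0F , δc≡a) = ⊥-elim (c≢b (collide δc≡a δb≡a))
    permutation (1F , δa≡b) (0F , δb≡a) (1F , δc≡b) = ⊥-elim (c≢a (collide δc≡b δa≡b))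
    permutation (1F , δa≡b) (2F , δb≡c) (1F , δc≡b) = ⊥-elim (c≢a (collide δc≡b δa≡b))
    permutation (2F , δa≡c) (0F , δb≡a) (0F , δc≡a) = ⊥-elim (c≢b (collide δc≡a δb≡a))
    permutation (2F , δa≡c) (2F , δb≡c) (0F , δc≡a) = ⊥-elim (a≢b (collide δa≡c δb≡c))
    permutation (2F , δa≡c) (2F , δb≡c) (1F , δc≡b) = ⊥-elim (a≢b (collide δa≡c δb≡c))

  Invariant⇒Balanced : ∀ {B} → Invariant B → Balanced B
  Invariant⇒Balanced {B} invariant x y x≢0 y≢0 = φ , preserves , reflects , surjective
    where
    γ = y * inv x
    γ≢0 : γ ≢ 0#
    γ≢0 = x*y≢0 y≢0 (inv≢0 x)
    γx≡y : γ * x ≡ y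
    γx≡y = b*inv[a]*a≡b x≢0 y
    forward = proj₁ (invariant γ γ≢0)
    backward = proj₂ (invariant γ γ≢0)
    φ : CovSet B x → CovSet B y
    φ (T , T∈B , x∈T) = let (T' , T'∈B , γT≐T') = forward T T∈B in
      T' , T'∈B , subst (Covers T') γx≡y
                    (Covers-SidesIn (scaleT γ T) T' (Covers-scaleT T γ x∈T) (proj₁ (SameTri⇒SidesIn _ _ γT≐T')))
    φ-SameTri : ∀ u → SameTri (scaleT γ (proj₁ u)) (proj₁ (φ u))
    φ-SameTri (T , T∈B , _) = proj₂ (proj₂ (forward T T∈B))
    preserves : ∀ u v → SameTri (proj₁ u) (proj₁ v) → SameTri (proj₁ (φ u)) (proj₁ (φ v))
    preserves u v u≐v = SameTri-trans _ _ _ (SameTri-sym _ _ (φ-SameTri u))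
                          (SameTri-trans _ _ _ (SameTri-scaleT _ _ γ u≐v) (φ-SameTri v))
    reflects : ∀ u v → SameTri (proj₁ (φ u)) (proj₁ (φ v)) → SameTri (proj₁ u) (proj₁ v)
    reflects u v φu≐φv = subst₂ SameTri (scaleT-inverseˡ γ≢0 (proj₁ u)) (scaleT-inverseˡ γ≢0 (proj₁ v))
      (SameTri-scaleT _ _ (inv γ) (SameTri-trans _ _ _ (φ-SameTri u) (SameTri-trans _ _ _ φu≐φv (SameTri-sym _ _ (φ-SameTri v)))))
    surjective : ∀ w → ∃ λ u → SameTri (proj₁ (φ u)) (proj₁ w)
    surjective (T , T∈B , y∈T) = let (T' , T'∈B , γT'≐T) = backward T T∈B in
      (T' , T'∈B , x∈T' T' γT'≐T) , SameTri-trans _ _ _ (SameTri-sym _ _ (φ-SameTri (T' , T'∈B , x∈T' T' γT'≐T))) γT'≐T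
      where
      x∈T' : ∀ T' → SameTri (scaleT γ T') T → Covers T' x
      x∈T' T' γT'≐T = subst₂ Covers (scaleT-inverseˡ γ≢0 T') (trans (cong (inv γ *_) (sym γx≡y)) (inv-cancelˡ γ≢0 x))
        (Covers-scaleT (scaleT γ T') (inv γ) (Covers-SidesIn T (scaleT γ T') y∈T (proj₂ (SameTri⇒SidesIn _ _ γT'≐T))))

  -- Normalised triangles and their blocks

  Key : Set
  Key = Fin N × Fin N × Fin N

  tri : Key → Triple
  tri (k₁ , k₂ , k₃) = 1# , e k₁ , e k₁ * e k₂

  exponent : Key → Fin 3 → Fin N
  exponent (k₁ , k₂ , k₃) 0F = k₁
  exponent (k₁ , k₂ , k₃) 1F = k₂
  exponent (k₁ , k₂ , k₃) 2F = k₃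

  SumZero : Key → Set
  SumZero (k₁ , k₂ , k₃) = toℕ (addZ (addZ k₁ k₂) k₃) ≡ 0

  e-sum : ∀ k₁ k₂ k₃ → e (addZ (addZ k₁ k₂) k₃) ≡ e k₁ * e k₂ * e k₃
  e-sum k₁ k₂ k₃ = trans (e-addZ (addZ k₁ k₂) k₃) (cong (_* e k₃) (e-addZ k₁ k₂))

  SumZero⇒product≡1 : ∀ {k₁ k₂ k₃} → SumZero (k₁ , k₂ , k₃) → e k₁ * e k₂ * e k₃ ≡ 1#
  SumZero⇒product≡1 {k₁} {k₂} {k₃} sum≡0 = trans (sym (e-sum k₁ k₂ k₃)) (cong (ξ ^F_) sum≡0)

  product≡1⇒SumZero : ∀ {k₁ k₂ k₃} → e k₁ * e k₂ * e k₃ ≡ 1# → SumZero (k₁ , k₂ , k₃)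
  product≡1⇒SumZero {k₁} {k₂} {k₃} prod≡1 = e≡1⇒toℕ≡0 _ (trans (e-sum k₁ k₂ k₃) prod≡1)

  side-ratio : ∀ t → SumZero t → ∀ s → corner (next s) (tri t) ≡ e (exponent t s) * corner s (tri t)
  side-ratio t sum≡0 0F = sym (*-identityʳ _)
  side-ratio t sum≡0 1F = *-comm _ _
  side-ratio t sum≡0 2F = sym (trans (*-comm _ _) (SumZero⇒product≡1 {proj₁ t} sum≡0))

  side-ratio-scaleT : ∀ {T k} s γ → corner (next s) T ≡ e k * corner s T →
                      corner (next s) (scaleT γ T) ≡ e k * corner s (scaleT γ T)
  side-ratio-scaleT {T} {k} s γ eq = begin
    corner (next s) (scaleT γ T)   ≡⟨ corner-scaleT (next s) γ T ⟩
    γ * corner (next s) T          ≡⟨ cong (γ *_) eq ⟩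
    γ * (e k * corner s T)         ≡⟨ x∙yz≈y∙xz γ (e k) (corner s T) ⟩
    e k * (γ * corner s T)         ≡⟨ cong (e k *_) (corner-scaleT s γ T) ⟨
    e k * corner s (scaleT γ T)    ∎
    where open ≡-Reasoning

  keyOf : Triple → Key
  keyOf (a , b , c) = log (b * inv a) , log (c * inv b) , log (a * inv c)

  keyOf-normalises : ∀ {T} → Independent T → tri (keyOf T) ≡ scaleT (inv (corner 0F T)) T × SumZero (keyOf T)
  keyOf-normalises {a , b , c} ((a≢0 , b≢0 , _) , c≢0 , _) =
    cong₂ _,_ (sym (inv-l a≢0)) (cong₂ _,_ (trans e₁ (*-comm b (inv a))) (trans (cong₂ _*_ e₁ e₂) b/a*c/b≡c/a)) ,
    product≡1⇒SumZero (trans (cong₂ _*_ (trans (cong₂ _*_ e₁ e₂) b/a*c/b≡c/a) e₃) c/a*a/c≡1)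
    where
    e-log-ratio : ∀ {x y} → x ≢ 0# → y ≢ 0# → e (log (y * inv x)) ≡ y * inv x
    e-log-ratio {x} x≢0 y≢0 = e-log (x*y≢0 y≢0 (inv≢0 x))
    e₁ = e-log-ratio a≢0 b≢0
    e₂ = e-log-ratio b≢0 c≢0
    e₃ = e-log-ratio c≢0 a≢0
    b/a*c/b≡c/a : b * inv a * (c * inv b) ≡ inv a * c
    b/a*c/b≡c/a = begin
      b * inv a * (c * inv b)      ≡⟨ cong (b * inv a *_) (*-comm c (inv b)) ⟩
      b * inv a * (inv b * c)      ≡⟨ interchange b (inv a) (inv b) c ⟩
      b * inv b * (inv a * c)      ≡⟨ cong (_* (inv a * c)) (inv-r b≢0) ⟩
      1# * (inv a * c)             ≡⟨ *-identityˡ _ ⟩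
      inv a * c                    ∎
      where open ≡-Reasoning
    c/a*a/c≡1 : inv a * c * (a * inv c) ≡ 1#
    c/a*a/c≡1 = trans (interchange (inv a) c a (inv c)) (trans (cong₂ _*_ (inv-l a≢0) (inv-r c≢0)) (*-identityˡ 1#))

  -- Block t is definitionally tabulate (entry t ∘ remQuot 6).
  entry : Key → Fin 3 × Fin 6 → Fin N
  entry t (s , j) = Γ-at (exponent t s) j

  entry∈Block : ∀ t p → entry t p ∈ Block t
  entry∈Block t (s , j) = subst (λ p → entry t p ∈ Block t) (remQuot-combine s j) (∈-tabulate⁺ {f = entry t ∘ remQuot 6} (combine s j))

  ∈Block⇒entry : ∀ {x} t → x ∈ Block t → ∃ λ p → x ≡ entry t p
  ∈Block⇒entry t x∈ with ∈-tabulate⁻ {f = entry t ∘ remQuot 6} x∈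
  ... | i , x≡ = remQuot 6 i , x≡

  Unique-Block⇒entry-injective : ∀ t → Unique (Block t) → ∀ {p q} → entry t p ≡ entry t q → p ≡ q
  Unique-Block⇒entry-injective t unique {s , j} {s' , j'} eq =
    trans (sym (remQuot-combine s j))
      (trans (cong (remQuot 6) (Unique-tabulate⁻ {f = entry t ∘ remQuot 6} unique {combine s j} {combine s' j'} eq′))
             (remQuot-combine s' j'))
    where
    eq′ : entry t (remQuot 6 (combine s j)) ≡ entry t (remQuot 6 (combine s' j'))
    eq′ = subst₂ (λ p q → entry t p ≡ entry t q) (sym (remQuot-combine s j)) (sym (remQuot-combine s' j')) eq

  entry-injective⇒Unique-Block : ∀ t → (∀ {p q} → entry t p ≡ entry t q → p ≡ q) → Unique (Block t)
  entry-injective⇒Unique-Block t injective = tabulate⁺ {f = entry t ∘ remQuot 6} λ {i} {j} eq →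
    trans (sym (combine-remQuot {3} 6 i))
          (trans (cong (uncurry combine) (injective {remQuot 6 i} {remQuot 6 j} eq)) (combine-remQuot {3} 6 j))

  entry-ratio : ∀ t → SumZero t → Independent (tri t) → ∀ p → e (entry t p) * first (tri t) p ≡ second (tri t) p
  entry-ratio t sum≡0 ind (s , j) =
    Γ-ratio (ratio≢1 {k = exponent t s} (Independent⇒Indep2 ind s) (side-ratio t sum≡0 s)) (side-ratio t sum≡0 s) j

  line-ratio∈Block : ∀ t {a b γ} i → SumZero t → Independent (tri t) → Indep2 a b → e i * a ≡ b → γ ≢ 0# →
                     InTri (Span a b) (scaleT γ (tri t)) → i ∈ Block t
  line-ratio∈Block t {γ = γ} i sum≡0 ind ab i-ratio γ≢0 ab∈γt with InTri⇒side (scaleT γ (tri t)) ab∈γt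
  ... | s , ab≐side with ratio∈Γ {k = exponent t s} i ab (Independent⇒Indep2 (Independent-scaleT γ γ≢0 ind) s)
                          (side-ratio-scaleT {k = exponent t s} s γ (side-ratio t sum≡0 s)) i-ratio ab≐side
  ...   | j , i≡ = subst (_∈ Block t) (sym i≡) (entry∈Block t (s , j))

  entry-line : ∀ t {a} → SumZero t → Independent (tri t) → ∀ p → a ≢ 0# →
               ∃ λ γ → γ ≢ 0# × InTri (Span a (e (entry t p) * a)) (scaleT γ (tri t))
  entry-line t sum≡0 ind (s , j) a≢0 with Γ-line {k = exponent t s} (Independent⇒Indep2 ind s) (side-ratio t sum≡0 s) j a≢0
  ... | γ , γ≢0 , line≐side = γ , γ≢0 , side⇒InTri (scaleT γ (tri t)) s (SameSet-trans line≐side (SameSet-sym (side-scaleT s γ (tri t))))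

  Block⇒line : ∀ t {x} → SumZero t → Independent (tri t) → x ∈ Block t →
               ∃ λ γ → γ ≢ 0# × InTri (Span 1# (e x)) (scaleT γ (tri t))
  Block⇒line t sum≡0 ind x∈ with ∈Block⇒entry t x∈
  ... | p , refl with entry-line t sum≡0 ind p 1≢0
  ...   | γ , γ≢0 , line∈ = γ , γ≢0 , InTri-resp (scaleT γ (tri t)) (Span-cong refl (sym (*-identityʳ _))) line∈

  InGZ? : ∀ i → Dec (InGZ i)
  InGZ? i = any? λ j → i Fin.≟ scaleZ g j

  module _ (m∣n : m ∣ n) where
    M : ℕ
    M = 2 ^ m ∸ 1

    0<M : 0 < M
    0<M = ℕ.m<n⇒0<n∸m (ℕ.^-monoʳ-< 2 (ℕ.s≤s (ℕ.s≤s ℕ.z≤n)) 0<m)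
      where
      0<m : 0 < m
      0<m = ℕ.n≢0⇒n>0 λ m≡0 → ℕ.<⇒≢ 0<n (sym (0∣⇒≡0 (subst (_∣ n) m≡0 m∣n)))

    g*M≡N : g ℕ.* M ≡ N
    g*M≡N = div'[a,b]*b≡a 0<M (2^m∸1∣2^n∸1 m∣n)

    Subfield-ξ^[g*j] : ∀ j → Subfield (ξ ^F (g ℕ.* j))
    Subfield-ξ^[g*j] j = begin
      (ξ ^F (g ℕ.* j)) ^F (2 ^ m)     ≡⟨ cong ((ξ ^F (g ℕ.* j)) ^F_) (2^m≡1+[2^m∸1] m) ⟩
      (ξ ^F (g ℕ.* j)) ^F suc M       ≡⟨ ^F-assocʳ ξ (g ℕ.* j) (suc M) ⟩
      ξ ^F (g ℕ.* j ℕ.* suc M)        ≡⟨ cong (ξ ^F_) (trans (expand g j M) (cong (λ k → g ℕ.* j ℕ.+ j ℕ.* k) g*M≡N)) ⟩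
      ξ ^F (g ℕ.* j ℕ.+ j ℕ.* N)      ≡⟨ ξ^-periodic (g ℕ.* j) j ⟩
      ξ ^F (g ℕ.* j)                  ∎
      where
      open ≡-Reasoning
      expand : ∀ g j M → g ℕ.* j ℕ.* suc M ≡ g ℕ.* j ℕ.+ j ℕ.* (g ℕ.* M)
      expand = +-*-Solver.solve 3 (λ g j M → g :* j :* (con 1 :+ M) := g :* j :+ j :* (g :* M)) refl
        where open +-*-Solver using (_:*_; _:+_; _:=_; con)

    InGZ⇒Subfield : ∀ {i} → InGZ i → Subfield (e i)
    InGZ⇒Subfield (j , refl) = subst Subfield (sym (e-residue (scaleZ-residue g j))) (Subfield-ξ^[g*j] (toℕ j))

    ξ^[i*M]≡1 : ∀ {i} → Subfield (e i) → ξ ^F (toℕ i ℕ.* M) ≡ 1#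
    ξ^[i*M]≡1 {i} e[i]∈ = *-cancelˡ (e≢0 i) (begin
      e i * ξ ^F (a ℕ.* M)     ≡⟨ ^F-homo-* ξ a (a ℕ.* M) ⟨
      ξ ^F (a ℕ.+ a ℕ.* M)     ≡⟨ cong (ξ ^F_) (ℕ.*-suc a M) ⟨
      ξ ^F (a ℕ.* suc M)       ≡⟨ ^F-assocʳ ξ a (suc M) ⟨
      e i ^F suc M             ≡⟨ cong (e i ^F_) (2^m≡1+[2^m∸1] m) ⟨
      e i ^F (2 ^ m)           ≡⟨ e[i]∈ ⟩
      e i                      ≡⟨ *-identityʳ _ ⟨
      e i * 1#                 ∎)
      where
      open ≡-Reasoning
      a = toℕ i

    g∣i⇒InGZ : ∀ {i} → g ∣ toℕ i → InGZ i
    g∣i⇒InGZ {i} (divides q i≡q*g) = j , toℕ-injective (begin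
      toℕ i                ≡⟨ trans i≡q*g (ℕ.*-comm q g) ⟩
      g ℕ.* q              ≡⟨ cong (g ℕ.*_) (toℕ-fromℕ< q<N) ⟨
      g ℕ.* toℕ j          ≡⟨ toℕ-scaleZ g j (subst (_< N) i≡g*j (toℕ<n i)) ⟨
      toℕ (scaleZ g j)     ∎)
      where
      open ≡-Reasoning
      0<g : 0 < g
      0<g = ℕ.n≢0⇒n>0 λ g≡0 → ℕ.<⇒≢ 0<N (trans (sym (cong (ℕ._* M) g≡0)) g*M≡N)
      q<N : q < N
      q<N = ℕ.≤-<-trans (ℕ.m≤m*n q g {{ℕ.>-nonZero 0<g}}) (subst (_< N) i≡q*g (toℕ<n i))
      j = fromℕ< q<N
      i≡g*j : toℕ i ≡ g ℕ.* toℕ j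
      i≡g*j = trans i≡q*g (trans (ℕ.*-comm q g) (cong (g ℕ.*_) (sym (toℕ-fromℕ< q<N))))

    Subfield⇒InGZ : ∀ {i} → Subfield (e i) → InGZ i
    Subfield⇒InGZ {i} e[i]∈ =
      g∣i⇒InGZ (*-cancelʳ-∣ M (subst (_∣ toℕ i ℕ.* M) (sym g*M≡N) (ξ^a≡1⇒N∣a _ (ξ^[i*M]≡1 {i} e[i]∈))))
      where instance _ = ℕ.>-nonZero 0<M

    Indep2-1,e : ∀ {i} → ¬ InGZ i → Indep2 1# (e i)
    Indep2-1,e {i} i∉gZ = 1≢0 , e≢0 i , λ 1≡e[i] → i∉gZ (Subfield⇒InGZ (subst Subfield 1≡e[i] Subfield-1))

    module DesignToPartition (B : Triple → Set) (isGDTD : IsGDTD B) (invariant : Invariant B) where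
      InDesign : Triple → Set
      InDesign T = ∃ λ T' → B T' × SameTri T T'

      InDesign-scaleT : ∀ {T} d → d ≢ 0# → InDesign T → InDesign (scaleT d T)
      InDesign-scaleT {T} d d≢0 (T' , T'∈B , T≐T') with proj₁ (invariant d d≢0) T' T'∈B
      ... | T'' , T''∈B , dT'≐T'' = T'' , T''∈B , SameTri-trans _ _ _ (SameTri-scaleT T T' d T≐T') dT'≐T''

      InTri-representative : ∀ {S T} → (D : InDesign T) → InTri S T → InTri S (proj₁ D)
      InTri-representative {T = T} (T' , _ , T≐T') S∈T = InTri-SidesIn T T' S∈T (proj₁ (SameTri⇒SidesIn T T' T≐T'))

      InDesign⇒Covered : ∀ {S T} → InDesign T → InTri S T → CoveredByB B S
      InDesign⇒Covered D S∈T = proj₁ D , proj₁ (proj₂ D) , InTri-representative D S∈T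

      covered⇒unique : ∀ {x y} → Indep2 x y → CoveredByB B (Span x y) → UniqueTriInB B (Span x y)
      covered⇒unique {x} {y} xy covered =
        [ proj₁ ∘ proj₂ , (λ (uncovered , _) → ⊥-elim (uncovered covered)) ]′ (proj₂ isGDTD x y xy)

      covered⇒∉group : ∀ {x y} → Indep2 x y → CoveredByB B (Span x y) → ¬ InSomeGroup (Span x y)
      covered⇒∉group {x} {y} xy covered =
        [ proj₂ ∘ proj₂ , (λ (uncovered , _) → ⊥-elim (uncovered covered)) ]′ (proj₂ isGDTD x y xy)

      line-unique : ∀ {x y T₁ T₂} → Indep2 x y → InDesign T₁ → InDesign T₂ →
                    InTri (Span x y) T₁ → InTri (Span x y) T₂ → SameTri T₁ T₂
      line-unique {x} {y} {T₁} {T₂} xy D₁@(T₁' , T₁'∈B , T₁≐T₁') D₂@(T₂' , T₂'∈B , T₂≐T₂') xy∈T₁ xy∈T₂ =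
        SameTri-trans T₁ T₁' T₂ T₁≐T₁' (SameTri-trans T₁' T₂' T₂
          (covered⇒unique xy (InDesign⇒Covered D₁ xy∈T₁) T₁' T₂' T₁'∈B (InTri-representative D₁ xy∈T₁)
                                                              T₂'∈B (InTri-representative D₂ xy∈T₂))
          (SameTri-sym T₂ T₂' T₂≐T₂'))

      side∉group : ∀ {T} → InDesign T → Independent T → ∀ s → ¬ InSomeGroup (side s T)
      side∉group {T} D ind s = covered⇒∉group (Independent⇒Indep2 ind s) (InDesign⇒Covered D (side⇒InTri T s SameSet-refl))

      side-stabiliser : ∀ {T δ s s'} → InDesign T → Independent T → δ ≢ 0# →
                        SameSet (side s (scaleT δ T)) (side s' T) → δ ≡ 1#
      side-stabiliser {T} {δ} {s} {s'} D ind δ≢0 δs≐s' = scaleT-stabiliser ind δ≢0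
        (line-unique (Independent⇒Indep2 ind s') (InDesign-scaleT δ δ≢0 D) D
          (side⇒InTri (scaleT δ T) s (SameSet-sym δs≐s')) (side⇒InTri T s' SameSet-refl))

      DesignKey : Key → Set
      DesignKey t = SumZero t × Independent (tri t) × InDesign (tri t)

      -- Equal entries give a scalar δ carrying one side of T onto another; then δT and T share a
      -- line, so δ = 1 and the two ordered pairs coincide.
      entry-injective : ∀ {t} → DesignKey t → ∀ {p q} → entry t p ≡ entry t q → p ≡ q
      entry-injective {t} (sum≡0 , ind , D) {p} {q} entry≡ = pair-determined ind (unscaled δu≡u') (unscaled δw≡w')
        where
        T = tri t
        s = proj₁ p
        u = first T p
        w = second T p
        u' = first T q
        w' = second T q
        r = e (entry t p)
        u≢0 : u ≢ 0#
        u≢0 = point≢0 (Independent⇒Indep2 ind s) (source (proj₂ p))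
        δ = u' * inv u
        δ≢0 : δ ≢ 0#
        δ≢0 = x*y≢0 (point≢0 (Independent⇒Indep2 ind (proj₁ q)) (source (proj₂ q))) (inv≢0 u)
        δu≡u' : δ * u ≡ u'
        δu≡u' = b*inv[a]*a≡b u≢0 u'
        δw≡w' : δ * w ≡ w'
        δw≡w' = begin
          δ * w          ≡⟨ cong (δ *_) (entry-ratio t sum≡0 ind p) ⟨
          δ * (r * u)    ≡⟨ x∙yz≈y∙xz δ r u ⟩
          r * (δ * u)    ≡⟨ cong₂ (λ k z → e k * z) entry≡ δu≡u' ⟩
          e (entry t q) * u' ≡⟨ entry-ratio t sum≡0 ind q ⟩
          w'             ∎
          where open ≡-Reasoning
        δ≡1 : δ ≡ 1#
        δ≡1 = side-stabiliser {T} {δ} {s} {proj₁ q} D ind δ≢0 (SameSet-trans (side-scaleT s δ T)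
                (SameSet-trans (SameSet-Span-* δ (SameSet-sym (pair-side T p))) (SameSet-trans (Span-cong δu≡u' δw≡w') (pair-side T q))))
        unscaled : ∀ {x y} → δ * x ≡ y → x ≡ y
        unscaled {x} δx≡y = trans (sym (*-identityˡ x)) (trans (cong (_* x) (sym δ≡1)) δx≡y)

      Block-not-in-gZ : ∀ {t} → DesignKey t → ∀ {x} → x ∈ Block t → ¬ InGZ x
      Block-not-in-gZ {t} (sum≡0 , ind , D) x∈ x∈gZ with ∈Block⇒entry t x∈
      ... | p , refl = side∉group D ind (proj₁ p) (first (tri t) p , first≢0 ind p , side⊆group)
        where
        side⊆group : InGroup (side (proj₁ p) (tri t)) (first (tri t) p)
        side⊆group y y∈side = Span-InGroup (InGZ⇒Subfield x∈gZ) (entry-ratio t sum≡0 ind p) y (proj₂ (pair-side (tri t) p y) y∈side)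

      covering-triangle⇒key : ∀ {i T} → ¬ InGZ i → B T → InTri (Span 1# (e i)) T → ∃ λ t → DesignKey t × i ∈ Block t
      covering-triangle⇒key {i} {T} i∉gZ T∈B line∈T =
        t , (proj₂ normal , ind' , D') , line-ratio∈Block t i (proj₂ normal) ind' (Indep2-1,e i∉gZ) (*-identityʳ (e i)) a≢0 line∈aT
        where
        ind : Independent T
        ind = proj₁ isGDTD _ _ _ T∈B
        a = corner 0F T
        a≢0 : a ≢ 0#
        a≢0 = proj₁ (proj₁ ind)
        t = keyOf T
        normal : tri t ≡ scaleT (inv a) T × SumZero t
        normal = keyOf-normalises {T} ind
        ind' : Independent (tri t)
        ind' = subst Independent (sym (proj₁ normal)) (Independent-scaleT {T} (inv a) (inv≢0 a) ind)
        D' : InDesign (tri t)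
        D' = subst InDesign (sym (proj₁ normal)) (InDesign-scaleT {T} (inv a) (inv≢0 a) (T , T∈B , SameTri-refl T))
        line∈aT : InTri (Span 1# (e i)) (scaleT a (tri t))
        line∈aT = subst (InTri (Span 1# (e i))) (sym (trans (cong (scaleT a) (proj₁ normal)) (scaleT-inverseʳ a≢0 T))) line∈T

      covering-key : ∀ i → ¬ InGZ i → ∃ λ t → DesignKey t × i ∈ Block t
      covering-key i i∉gZ =
        [ (λ ((_ , T∈B , line∈T) , _) → covering-triangle⇒key i∉gZ T∈B line∈T) ,
          (λ (_ , (_ , _ , line⊆group) , _) → ⊥-elim (i∉gZ (Subfield⇒InGZ (InGroup⇒Subfield 1≢0 (*-identityʳ (e i)) line⊆group)))) ]′
        (proj₂ isGDTD 1# (e i) (Indep2-1,e i∉gZ))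

      Block-disjoint : ∀ {t₁ t₂ i x} → DesignKey t₁ → DesignKey t₂ →
                       i ∈ Block t₁ → i ∈ Block t₂ → x ∈ Block t₁ → x ∈ Block t₂
      Block-disjoint {t₁} {t₂} {x = x} key₁@(_ , ind₁ , D₁) key₂@(sum₂≡0 , ind₂ , D₂) i∈₁ i∈₂ x∈₁
        with Block⇒line t₁ (proj₁ key₁) ind₁ i∈₁ | Block⇒line t₂ sum₂≡0 ind₂ i∈₂ | Block⇒line t₁ (proj₁ key₁) ind₁ x∈₁
      ... | γ₁ , γ₁≢0 , i∈γ₁t₁ | γ₂ , γ₂≢0 , i∈γ₂t₂ | μ , μ≢0 , x∈μt₁ =
        line-ratio∈Block t₂ x sum₂≡0 ind₂ (Indep2-1,e (Block-not-in-gZ key₁ x∈₁)) (*-identityʳ (e x))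
          (x*y≢0 (x*y≢0 μ≢0 (inv≢0 γ₁)) γ₂≢0) (InTri-rescale γ₁≢0 γ₁t₁≐γ₂t₂ x∈μt₁)
        where
        γ₁t₁≐γ₂t₂ : SameTri (scaleT γ₁ (tri t₁)) (scaleT γ₂ (tri t₂))
        γ₁t₁≐γ₂t₂ = line-unique (Indep2-1,e (Block-not-in-gZ key₁ i∈₁))
                      (InDesign-scaleT γ₁ γ₁≢0 D₁) (InDesign-scaleT γ₂ γ₂≢0 D₂) i∈γ₁t₁ i∈γ₂t₂

      partition : IsPartition DesignKey
      partition = (λ _ _ _ key → proj₁ key) ,
                  (λ t key → entry-injective⇒Unique-Block t (entry-injective key)) ,
                  (λ t key → All.tabulate (Block-not-in-gZ key)) ,
                  covering-key ,
                  λ _ _ _ key key' i∈ i∈' _ → Block-disjoint key key' i∈ i∈' , Block-disjoint key' key i∈' i∈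

    module PartitionToDesign (P : Key → Set) (isPartition : IsPartition P) where
      P⇒SumZero : ∀ {t} → P t → SumZero t
      P⇒SumZero {k₁ , k₂ , k₃} = proj₁ isPartition k₁ k₂ k₃

      P⇒Unique : ∀ {t} → P t → Unique (Block t)
      P⇒Unique = proj₁ (proj₂ isPartition) _

      P⇒Block∉gZ : ∀ {t x} → P t → x ∈ Block t → ¬ InGZ x
      P⇒Block∉gZ Pt = All.lookup (proj₁ (proj₂ (proj₂ isPartition)) _ Pt)

      P-covers : ∀ i → ¬ InGZ i → ∃ λ t → P t × i ∈ Block t
      P-covers = proj₁ (proj₂ (proj₂ (proj₂ isPartition)))

      P-disjoint : ∀ {i t t'} → P t → P t' → i ∈ Block t → i ∈ Block t' → SameList (Block t) (Block t')
      P-disjoint = proj₂ (proj₂ (proj₂ (proj₂ isPartition))) _ _ _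

      SameList-sym : ∀ {xs ys} → SameList xs ys → SameList ys xs
      SameList-sym xs≐ys j = proj₂ (xs≐ys j) , proj₁ (xs≐ys j)

      SameList-trans : ∀ {xs ys zs} → SameList xs ys → SameList ys zs → SameList xs zs
      SameList-trans xs≐ys ys≐zs j = proj₁ (ys≐zs j) ∘ proj₁ (xs≐ys j) , proj₂ (xs≐ys j) ∘ proj₂ (ys≐zs j)

      choose : ∀ k → Dec (InGZ k) → Key
      choose k (yes _)     = k , k , k  -- junk: only used for k ∉ gℤ
      choose k (no k∉gZ) = proj₁ (P-covers k k∉gZ)

      choose-spec : ∀ {k} (k∈gZ? : Dec (InGZ k)) → ¬ InGZ k → P (choose k k∈gZ?) × k ∈ Block (choose k k∈gZ?)
      choose-spec (yes k∈gZ) k∉gZ = ⊥-elim (k∉gZ k∈gZ)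
      choose-spec (no k∉gZ)  _    = proj₂ (P-covers _ k∉gZ)

      -- Opaque, so that conversion checking never unfolds a minimum over a concrete block.
      opaque
        chosen : Fin N → Key
        chosen k = choose k (InGZ? k)

        chosen-spec : ∀ {k} → ¬ InGZ k → P (chosen k) × k ∈ Block (chosen k)
        chosen-spec {k} = choose-spec (InGZ? k)

        least : Key → Fin N
        least t = Extrema.min (≤-totalOrder N) (proj₁ t) (Block t)

        least∈Block : ∀ t → least t ∈ Block t
        least∈Block t = min-∈ {⊤ = proj₁ t} {xs = Block t} (entry∈Block t (0F , 0F))

        least-cong : ∀ {t t'} → SameList (Block t) (Block t') → least t ≡ least t'
        least-cong {t} {t'} = min-cong {⊤ = proj₁ t} {⊤' = proj₁ t'} {xs = Block t} {ys = Block t'}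
                                  (entry∈Block t (0F , 0F)) (entry∈Block t' (0F , 0F))

      representative : Fin N → Key
      representative k = chosen (least (chosen k))

      representative-spec : ∀ {k} → ¬ InGZ k →
                            P (representative k) × SameList (Block (chosen k)) (Block (representative k))
      representative-spec {k} k∉gZ =
        proj₁ (chosen-spec μ∉gZ) , P-disjoint Pk (proj₁ (chosen-spec μ∉gZ)) μ∈ (proj₂ (chosen-spec μ∉gZ))
        where
        Pk = proj₁ (chosen-spec k∉gZ)
        μ∈ = least∈Block (chosen k)
        μ∉gZ = P⇒Block∉gZ Pk μ∈

      P-representative : ∀ {k} → ¬ InGZ k → P (representative k)
      P-representative k∉gZ = proj₁ (representative-spec k∉gZ)

      ∈Block-representative : ∀ {k} → ¬ InGZ k → k ∈ Block (representative k)
      ∈Block-representative k∉gZ = proj₁ (proj₂ (representative-spec k∉gZ) _) (proj₂ (chosen-spec k∉gZ))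

      representative-unique : ∀ {j k k'} → ¬ InGZ k → ¬ InGZ k' →
                              j ∈ Block (representative k) → j ∈ Block (representative k') → representative k ≡ representative k'
      representative-unique {j} {k} {k'} k∉gZ k'∉gZ j∈ j∈' = cong chosen (least-cong
        (SameList-trans (proj₂ (representative-spec k∉gZ))
          (SameList-trans (P-disjoint (P-representative k∉gZ) (P-representative k'∉gZ) j∈ j∈')
            (SameList-sym (proj₂ (representative-spec k'∉gZ))))))

      e[exponent]≢1 : ∀ {τ} → P τ → ∀ s → e (exponent τ s) ≢ 1#
      e[exponent]≢1 {τ} Pτ s e≡1 = P⇒Block∉gZ Pτ (entry∈Block τ (s , 0F)) (Subfield⇒InGZ (subst Subfield (sym e≡1) Subfield-1))

      Independent-tri : ∀ {τ} → P τ → Independent (tri τ)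
      Independent-tri {k₁ , k₂ , k₃} Pτ = (1≢0 , e≢0 k₁ , X≢1 ∘ sym) , x*y≢0 (e≢0 k₁) (e≢0 k₂) , XY≢1 , XY≢X , XY≢1+X
        where
        X≢1 = e[exponent]≢1 Pτ 0F
        XYZ≡1 : e k₁ * e k₂ * e k₃ ≡ 1#
        XYZ≡1 = SumZero⇒product≡1 {k₁} {k₂} {k₃} (P⇒SumZero Pτ)
        XY≢1 : e k₁ * e k₂ ≢ 1#
        XY≢1 XY≡1 = e[exponent]≢1 Pτ 2F (trans (sym (*-identityˡ (e k₃))) (trans (cong (_* e k₃) (sym XY≡1)) XYZ≡1))
        XY≢X : e k₁ * e k₂ ≢ e k₁
        XY≢X XY≡X = e[exponent]≢1 Pτ 1F (*-cancelˡ (e≢0 k₁) (trans XY≡X (sym (*-identityʳ (e k₁)))))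
        XY≡e[-k₃] : e k₁ * e k₂ ≡ e (negZ k₃)
        XY≡e[-k₃] = *-cancelʳ (e≢0 k₃) (trans XYZ≡1 (sym (e-negZ k₃)))
        -- 1 + ξ^k₁ = ξ^Z(k₁) and ξ^(k₁+k₂) = ξ^(-k₃) are the entries at (0, 1) and (2, 5).
        XY≢1+X : e k₁ * e k₂ ≢ 1# + e k₁
        XY≢1+X XY≡1+X = 0F≢2F (cong proj₁ (Unique-Block⇒entry-injective (k₁ , k₂ , k₃) (P⇒Unique Pτ) {0F , 1F} {2F , 5F}
                          (e-injective (trans (e-Zech k₁ X≢1) (trans (sym XY≡1+X) XY≡e[-k₃])))))
          where
          0F≢2F : (Fin 3 ∋ 0F) ≢ 2F
          0F≢2F ()

      -- δ maps (c, d) to an ordered pair on side s' with the same ratio ξ^(exponent τ s); as the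
      -- block entries are distinct, that pair is (c, d) itself.
      side-stabiliser : ∀ {τ δ s s'} → P τ → δ ≢ 0# → SameSet (side s (scaleT δ (tri τ))) (side s' (tri τ)) → δ ≡ 1#
      side-stabiliser {τ} {δ} {s} {s'} Pτ δ≢0 δs≐s' =
        from-pair (Span⇒pair δc∈s' δd∈s' (x*y≢0 δ≢0 c≢0) (x*y≢0 δ≢0 d≢0) (c≢d ∘ *-cancelˡ δ≢0))
        where
        T = tri τ
        ind = Independent-tri Pτ
        c = corner s T
        d = corner (next s) T
        c≢0 = proj₁ (Independent⇒Indep2 ind s)
        d≢0 = proj₁ (proj₂ (Independent⇒Indep2 ind s))
        c≢d = proj₂ (proj₂ (Independent⇒Indep2 ind s))
        δc∈s' = proj₁ (δs≐s' (δ * c)) (proj₂ (side-scaleT s δ T (δ * c)) Span-a)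
        δd∈s' = proj₁ (δs≐s' (δ * d)) (proj₂ (side-scaleT s δ T (δ * d)) Span-b)
        from-pair : (∃ λ j → δ * c ≡ first T (s' , j) × δ * d ≡ second T (s' , j)) → δ ≡ 1#
        from-pair (j , δc≡u , δd≡w) = same-position (Unique-Block⇒entry-injective τ (P⇒Unique Pτ) same-ratio) δc≡u
          where
          same-ratio : entry τ (s , 0F) ≡ entry τ (s' , j)
          same-ratio = e-injective (*-cancelʳ (x*y≢0 δ≢0 c≢0) (begin
            e (exponent τ s) * (δ * c)               ≡⟨ x∙yz≈y∙xz (e (exponent τ s)) δ c ⟩
            δ * (e (exponent τ s) * c)               ≡⟨ cong (δ *_) (side-ratio τ (P⇒SumZero Pτ) s) ⟨
            δ * d                                    ≡⟨ δd≡w ⟩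
            second T (s' , j)                        ≡⟨ entry-ratio τ (P⇒SumZero Pτ) ind (s' , j) ⟨
            e (entry τ (s' , j)) * first T (s' , j)  ≡⟨ cong (e (entry τ (s' , j)) *_) δc≡u ⟨
            e (entry τ (s' , j)) * (δ * c)           ∎))
            where open ≡-Reasoning
          same-position : (s , 0F) ≡ (s' , j) → δ * c ≡ first T (s' , j) → δ ≡ 1#
          same-position refl = δ*x≡x⇒δ≡1 c≢0

      scale-unique : ∀ {τ S γ γ'} → P τ → γ ≢ 0# → γ' ≢ 0# →
                     InTri S (scaleT γ (tri τ)) → InTri S (scaleT γ' (tri τ)) → γ ≡ γ'
      scale-unique {τ} {S} {γ} {γ'} Pτ γ≢0 γ'≢0 S∈γT S∈γ'T with InTri⇒side _ S∈γT | InTri⇒side _ S∈γ'T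
      ... | s , S≐s | s' , S≐s' = begin
        γ                    ≡⟨ *-identityˡ γ ⟨
        1# * γ               ≡⟨ cong (_* γ) (inv-r γ'≢0) ⟨
        γ' * inv γ' * γ      ≡⟨ *-assoc γ' (inv γ') γ ⟩
        γ' * δ               ≡⟨ cong (γ' *_) δ≡1 ⟩
        γ' * 1#              ≡⟨ *-identityʳ γ' ⟩
        γ'                   ∎
        where
        open ≡-Reasoning
        T = tri τ
        δ = inv γ' * γ
        δ≡1 : δ ≡ 1#
        δ≡1 = side-stabiliser {τ} {δ} {s} {s'} Pτ (x*y≢0 (inv≢0 γ') γ≢0) (subst₂ (λ U V → SameSet (side s U) (side s' V))
                (scaleT-scaleT (inv γ') γ T) (scaleT-inverseˡ γ'≢0 T)
                (side-scaleT-cong {s} {s'} {scaleT γ T} {scaleT γ' T} (inv γ') (SameSet-trans (SameSet-sym S≐s) S≐s')))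

      InOrbits : Triple → Set
      InOrbits T = ∃ λ k → ¬ InGZ k × ∃ λ γ → γ ≢ 0# × T ≡ scaleT γ (tri (representative k))

      InOrbits⇒Independent : ∀ {T} → InOrbits T → Independent T
      InOrbits⇒Independent (k , k∉gZ , γ , γ≢0 , refl) = Independent-scaleT γ γ≢0 (Independent-tri (P-representative k∉gZ))

      log-ratio∈Block : ∀ {a b T} → Indep2 a b → (D : InOrbits T) → InTri (Span a b) T →
                        log (b * inv a) ∈ Block (representative (proj₁ D))
      log-ratio∈Block ab (k , k∉gZ , γ , γ≢0 , refl) ab∈T =
        line-ratio∈Block (representative k) _ (P⇒SumZero Pk) (Independent-tri Pk) ab (log-ratio ab) γ≢0 ab∈T
        where Pk = P-representative k∉gZ

      ratio∈gZ⇒line-in-group : ∀ {a b} → Indep2 a b → InGZ (log (b * inv a)) →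
                               ¬ CoveredByB InOrbits (Span a b) × InExactlyOneGroup (Span a b)
      ratio∈gZ⇒line-in-group {a} ab@(a≢0 , _) i∈gZ =
        (λ { (T , D@(k , k∉gZ , _) , ab∈T) → P⇒Block∉gZ (P-representative k∉gZ) (log-ratio∈Block ab D ab∈T) i∈gZ }) ,
        (a , a≢0 , Span-InGroup (InGZ⇒Subfield i∈gZ) (log-ratio ab)) ,
        λ _ _ _ _ → InGroup-unique a≢0 Span-a

      ratio∉gZ⇒line-in-design : ∀ {a b} → Indep2 a b → ¬ InGZ (log (b * inv a)) →
        CoveredByB InOrbits (Span a b) × UniqueTriInB InOrbits (Span a b) × ¬ InSomeGroup (Span a b)
      ratio∉gZ⇒line-in-design {a} {b} ab@(a≢0 , _) i∉gZ = covered , unique ,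
        λ { (_ , _ , ab⊆group) → i∉gZ (Subfield⇒InGZ (InGroup⇒Subfield a≢0 (log-ratio ab) ab⊆group)) }
        where
        i = log (b * inv a)
        τ = representative i
        Pτ = P-representative i∉gZ
        covered : CoveredByB InOrbits (Span a b)
        covered =
          let (p , i≡entry) = ∈Block⇒entry τ (∈Block-representative i∉gZ)
              (γ , γ≢0 , line∈γτ) = entry-line τ (P⇒SumZero Pτ) (Independent-tri Pτ) p a≢0
          in scaleT γ (tri τ) , (i , i∉gZ , γ , γ≢0 , refl) ,
             InTri-resp (scaleT γ (tri τ)) (Span-cong refl (trans (sym (log-ratio ab)) (cong (λ k → e k * a) i≡entry))) line∈γτ
        unique : UniqueTriInB InOrbits (Span a b)
        unique _ _ D@(k , k∉gZ , γ , γ≢0 , refl) ab∈T D'@(k' , k'∉gZ , γ' , γ'≢0 , refl) ab∈T' =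
          ≡⇒SameTri (cong₂ (λ γ τ → scaleT γ (tri τ)) γ≡γ' τ≡τ')
          where
          τ≡τ' = representative-unique k∉gZ k'∉gZ (log-ratio∈Block ab D ab∈T) (log-ratio∈Block ab D' ab∈T')
          γ≡γ' = scale-unique (P-representative k∉gZ) γ≢0 γ'≢0 ab∈T
                   (subst (λ τ → InTri (Span a b) (scaleT γ' (tri τ))) (sym τ≡τ') ab∈T')

      isGDTD : IsGDTD InOrbits
      isGDTD = (λ _ _ _ → InOrbits⇒Independent) , λ a b ab → case InGZ? (log (b * inv a)) of λ where
        (yes i∈gZ) → inj₂ (ratio∈gZ⇒line-in-group ab i∈gZ)
        (no i∉gZ)  → inj₁ (ratio∉gZ⇒line-in-design ab i∉gZ)

      InOrbits-scaleT : ∀ {T} d → d ≢ 0# → InOrbits T → InOrbits (scaleT d T)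
      InOrbits-scaleT d d≢0 (k , k∉gZ , γ , γ≢0 , refl) = k , k∉gZ , d * γ , x*y≢0 d≢0 γ≢0 , scaleT-scaleT d γ _

      invariant : Invariant InOrbits
      invariant γ γ≢0 =
        (λ T D → scaleT γ T , InOrbits-scaleT γ γ≢0 D , SameTri-refl _) ,
        (λ T D → scaleT (inv γ) T , InOrbits-scaleT (inv γ) (inv≢0 γ) D , ≡⇒SameTri (scaleT-inverseʳ γ≢0 T))

theorem2 : (n m : ℕ) → m ∣ n → (K : GF2 n) →
    let open Design K m in
    (DesignExists ⇔ PartitionExists) ×
    (∀ B → IsGDTD B → Invariant B → Balanced B)
theorem2 n m m∣n K =
  mk⇔ (λ (B , isGDTD , invariant) → _ , DesignToPartition.partition m∣n B isGDTD invariant)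
      (λ (P , isPartition) → _ , PartitionToDesign.isGDTD m∣n P isPartition , PartitionToDesign.invariant m∣n P isPartition) ,
  λ _ _ → Invariant⇒Balanced
  where open TriangleDesigns K m
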